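{- Let $G_1,G_2$ be disjoint Eulerian graphs and let $G=G_1\circ G_2$ where $\circ$ is one of the operations $\odot_V,\odot_E,\odot_{VE}$ (with arbitrary choices of the vertices/edges involved). Then $\nu(G)-c(G)=(\nu(G_1)-c(G_1))+(\nu(G_2)-c(G_2))$.
   Context: Graphs are finite, loopless, parallel edges allowed. A graph is Eulerian if it has a closed walk with $v_0=v_k$ containing every edge exactly once. A cycle is a graph obtained from a path $u_0\dots u_k$ ($k\ge1$) by adding an edge $u_ku_0$. $c(G)$, $\nu(G)$ are the minimum and maximum number of cycles in a decomposition of $E(G)$ into edge-disjoint cycles. For disjoint $G_1,G_2$, $w_i\in V(G_i)$, and edges $e_i\in E(G_i)$ with end vertices $u_i,v_i$: $(G_1,w_1)\odot_V(G_2,w_2)$ identifies $w_1$ and $w_2$; $(G_1,e_1,u_1)\odot_E(G_2,e_2,u_2)$ deletes $e_1,e_2$ and adds edges $u_1u_2$ and $v_1v_2$; $(G_1,e_1,u_1)\odot_{VE}(G_2,e_2,u_2)$ deletes $e_1,e_2$, identifies $v_1$ with $v_2$, and adds an edge $u_1u_2$. -}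

module Defs where

open import Data.Nat using (ℕ; zero; suc; pred; _+_; _≤_; _∸_)
open import Data.Fin using (Fin; zero; suc; _↑ˡ_; _↑ʳ_; splitAt; punchIn; punchOut; _≟_)
open import Data.Product using (Σ; ∃; _×_; _,_; proj₁; proj₂) renaming (map to mapP)
open import Data.Sum using (_⊎_; inj₁; inj₂; [_,_]′)
open import Data.Bool using (Bool; true; false)
open import Data.List using (List; []; _∷_; map; length; concatMap)
open import Data.List.Membership.Propositional using (_∈_)
open import Data.List.Relation.Unary.Unique.Propositional using (Unique)
open import Relation.Nullary using (yes; no)
open import Relation.Binary.PropositionalEquality using (_≡_; _≢_)

-- Finite multigraphs: vertices Fin nV, edges Fin nE, each edge has two
-- end vertices (stored as an ordered pair; the graph is undirected).
-- Parallel edges are allowed.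

record Graph : Set where
  constructor graph
  field
    nV   : ℕ
    nE   : ℕ
    ends : Fin nE → Fin nV × Fin nV

open Graph public

Loopless : Graph → Set
Loopless G = ∀ e → proj₁ (ends G e) ≢ proj₂ (ends G e)

Joins : (G : Graph) → Fin (nE G) → Fin (nV G) → Fin (nV G) → Set
Joins G e x y = (ends G e ≡ (x , y)) ⊎ (ends G e ≡ (y , x))

-- A walk  x = v0, e1, v1, ..., ek, vk = y  given by its list of steps (e_i , v_i)
WalkFromTo : (G : Graph) → Fin (nV G) → List (Fin (nE G) × Fin (nV G)) → Fin (nV G) → Set
WalkFromTo G x []              y = x ≡ y
WalkFromTo G x ((e , z) ∷ st)  y = Joins G e x z × WalkFromTo G z st y

Eulerian : Graph → Set
Eulerian G = Σ (Fin (nV G)) λ x → Σ (List (Fin (nE G) × Fin (nV G))) λ st →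
  WalkFromTo G x st x × Unique (map proj₁ st) × (∀ e → e ∈ map proj₁ st)

-- A cycle u0 f0 u1 f1 ... uk fk u0 (k ≥ 1) in G: a closed walk from u0 with
-- steps (f0,u1),...,(fk,u0), at least two steps, pairwise distinct vertices
-- u1,...,uk,u0 and pairwise distinct edges.
record Cycle (G : Graph) : Set where
  constructor cycle
  field
    start    : Fin (nV G)
    steps    : List (Fin (nE G) × Fin (nV G))
    closed   : WalkFromTo G start steps start
    atLeast2 : 2 ≤ length steps
    distinctV : Unique (map proj₂ steps)
    distinctE : Unique (map proj₁ steps)

cycleEdges : {G : Graph} → Cycle G → List (Fin (nE G))
cycleEdges C = map proj₁ (Cycle.steps C)

IsDecomposition : (G : Graph) → List (Cycle G) → Set
IsDecomposition G cs = Unique (concatMap cycleEdges cs) × (∀ e → e ∈ concatMap cycleEdges cs)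

IsMinCycleNumber : Graph → ℕ → Set
IsMinCycleNumber G k =
  (Σ (List (Cycle G)) λ cs → IsDecomposition G cs × length cs ≡ k)
  × (∀ cs → IsDecomposition G cs → k ≤ length cs)

IsMaxCycleNumber : Graph → ℕ → Set
IsMaxCycleNumber G k =
  (Σ (List (Cycle G)) λ cs → IsDecomposition G cs × length cs ≡ k)
  × (∀ cs → IsDecomposition G cs → length cs ≤ k)

-- Operations. G1 and G2 are made disjoint by taking the disjoint union
-- Fin n1 ⊎ Fin n2 (encoded as Fin (n1 + n2)).

leftV : ∀ {n1} n2 → Fin n1 → Fin (n1 + n2)
leftV n2 v = v ↑ˡ n2

-- vertices of G2 inside the vertex set in which w2 ∈ V(G2) is identified
-- with w1 ∈ V(G1): w2 ↦ w1, other vertices are kept (renumbered).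
mergeMap : ∀ {n1 n2} → Fin n1 → Fin n2 → Fin n2 → Fin (n1 + pred n2)
mergeMap {n1} {suc k} w1 w2 v with w2 ≟ v
... | yes _ = w1 ↑ˡ k
... | no p  = n1 ↑ʳ punchOut p

-- the edges of G remaining after deleting edge d: index i ↦ old edge
delEdge : ∀ {m} → Fin m → Fin (pred m) → Fin m
delEdge {suc a} d i = punchIn d i

-- the chosen end u of an edge (true: first component, false: second) and the other end v
endU : (G : Graph) → Fin (nE G) → Bool → Fin (nV G)
endU G e true  = proj₁ (ends G e)
endU G e false = proj₂ (ends G e)

endV : (G : Graph) → Fin (nE G) → Bool → Fin (nV G)
endV G e true  = proj₂ (ends G e)
endV G e false = proj₁ (ends G e)

-- (G1,w1) ⊙V (G2,w2): identify w1 and w2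
opV : (G1 : Graph) → Fin (nV G1) → (G2 : Graph) → Fin (nV G2) → Graph
opV G1 w1 G2 w2 = graph (nV G1 + pred (nV G2)) (nE G1 + nE G2) es
  where
  es : Fin (nE G1 + nE G2) → _
  es e = [ (λ e₁ → mapP (leftV (pred (nV G2))) (leftV (pred (nV G2))) (ends G1 e₁))
         , (λ e₂ → mapP (mergeMap w1 w2) (mergeMap w1 w2) (ends G2 e₂)) ]′
         (splitAt (nE G1) e)

-- (G1,e1,u1) ⊙E (G2,e2,u2): delete e1,e2, add edges u1u2 and v1v2
-- (s1, s2 select which end of e1, e2 is u1, u2)
opE : (G1 : Graph) → Fin (nE G1) → Bool → (G2 : Graph) → Fin (nE G2) → Bool → Graph
opE G1 e1 s1 G2 e2 s2 =
  graph (nV G1 + nV G2) ((pred (nE G1) + pred (nE G2)) + 2) es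
  where
  L : Fin (nV G1) → Fin (nV G1 + nV G2)
  L v = v ↑ˡ nV G2
  R : Fin (nV G2) → Fin (nV G1 + nV G2)
  R v = nV G1 ↑ʳ v
  new : Fin 2 → Fin (nV G1 + nV G2) × Fin (nV G1 + nV G2)
  new zero    = L (endU G1 e1 s1) , R (endU G2 e2 s2)
  new (suc _) = L (endV G1 e1 s1) , R (endV G2 e2 s2)
  old : Fin (pred (nE G1) + pred (nE G2)) → Fin (nV G1 + nV G2) × Fin (nV G1 + nV G2)
  old e = [ (λ i → mapP L L (ends G1 (delEdge e1 i)))
          , (λ i → mapP R R (ends G2 (delEdge e2 i))) ]′ (splitAt (pred (nE G1)) e)
  es : Fin ((pred (nE G1) + pred (nE G2)) + 2) → _
  es e = [ old , new ]′ (splitAt (pred (nE G1) + pred (nE G2)) e)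

-- (G1,e1,u1) ⊙VE (G2,e2,u2): delete e1,e2, identify v1 with v2, add edge u1u2
opVE : (G1 : Graph) → Fin (nE G1) → Bool → (G2 : Graph) → Fin (nE G2) → Bool → Graph
opVE G1 e1 s1 G2 e2 s2 =
  graph (nV G1 + pred (nV G2)) ((pred (nE G1) + pred (nE G2)) + 1) es
  where
  L : Fin (nV G1) → Fin (nV G1 + pred (nV G2))
  L v = v ↑ˡ pred (nV G2)
  R : Fin (nV G2) → Fin (nV G1 + pred (nV G2))
  R v = mergeMap (endV G1 e1 s1) (endV G2 e2 s2) v
  new : Fin 1 → Fin (nV G1 + pred (nV G2)) × Fin (nV G1 + pred (nV G2))
  new _ = L (endU G1 e1 s1) , R (endU G2 e2 s2)
  old : Fin (pred (nE G1) + pred (nE G2)) → Fin (nV G1 + pred (nV G2)) × Fin (nV G1 + pred (nV G2))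
  old e = [ (λ i → mapP L L (ends G1 (delEdge e1 i)))
          , (λ i → mapP R R (ends G2 (delEdge e2 i))) ]′ (splitAt (pred (nE G1)) e)
  es : Fin ((pred (nE G1) + pred (nE G2)) + 1) → _
  es e = [ old , new ]′ (splitAt (pred (nE G1) + pred (nE G2)) e)

DefectAdditive : Graph → Graph → Graph → Set
DefectAdditive G1 G2 G =
  ∀ c ν c₁ ν₁ c₂ ν₂ →
  IsMinCycleNumber G c → IsMaxCycleNumber G ν →
  IsMinCycleNumber G1 c₁ → IsMaxCycleNumber G1 ν₁ →
  IsMinCycleNumber G2 c₂ → IsMaxCycleNumber G2 ν₂ →
  ν ∸ c ≡ (ν₁ ∸ c₁) + (ν₂ ∸ c₂)

module Submission where

-- For each operation there is an offset δ (0 for ⊙V, 1 for ⊙E and ⊙VE) and a transfer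
-- of cycle decompositions in both directions:
--  * forward: decompositions of G1 and G2 with a and b cycles give one of G with
--    a + b − δ cycles (for ⊙E/⊙VE the cycles through e1 and e2 are opened into paths,
--    which are glued along the new edge(s) into a single cycle of G);
--  * backward: a decomposition of G with m cycles gives decompositions of G1 and G2
--    with m + δ cycles in total (a cycle avoiding the new edges lies in one side,
--    because the sides meet in at most one vertex; the cycle through the new edge(s)
--    splits into two paths, closed up again by e1 and e2).
-- Hence c and ν are both shifted by δ, and the defect ν − c is additive.

open import Defs
open import Data.Nat using (ℕ; zero; suc; pred; _+_; _≤_; _∸_; s≤s; z≤n)
open import Data.Nat.Properties
  using (+-suc; +-comm; +-identityʳ; ≤-antisym; ≤-trans; ≤-reflexive; +-mono-≤;
         +-monoˡ-≤; m+[n∸m]≡n; [m+n]∸[m+o]≡n∸o; m+n∸m≡n; +-commutativeSemigroup)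
open import Algebra.Properties.CommutativeSemigroup +-commutativeSemigroup using (interchange)
open import Data.Fin using (Fin; zero; suc; _↑ˡ_; _↑ʳ_; splitAt; punchOut; _≟_)
open import Data.Fin.Properties
  using (↑ˡ-injective; ↑ʳ-injective; splitAt-↑ˡ; splitAt-↑ʳ; join-splitAt;
         punchIn-injective; punchInᵢ≢i; punchIn-punchOut; punchOut-injective)
open import Data.Product using (Σ; _×_; _,_; proj₁; proj₂) renaming (map to mapP)
open import Data.Sum using (_⊎_; inj₁; inj₂; [_,_]′)
open import Data.Bool using (Bool; true; false; not)
open import Data.Bool.Properties using () renaming (_≟_ to _≟B_)
open import Data.Unit using (⊤; tt)
open import Data.Empty using (⊥; ⊥-elim)
open import Data.List using (List; []; _∷_; map; length; concat; concatMap; _++_; [_]; allFin)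
open import Data.List.Properties using (map-++; length-++; length-map; map-∘; map-id; concat-++)
import Data.List.Properties as List
open import Data.List.Membership.Propositional using (_∈_; _∉_)
open import Data.List.Membership.Propositional.Properties
  using (∈-∃++; ∈-++⁺ˡ; ∈-++⁺ʳ; ∈-++⁻; ∈-map⁺; ∈-map⁻; ∈-concat⁺′; ∈-concat⁻′; ∈-allFin)
open import Data.List.Relation.Unary.Any using (here; there; any?)
open import Data.List.Relation.Unary.All using (All; []; _∷_)
import Data.List.Relation.Unary.All as All
import Data.List.Relation.Unary.All.Properties as All
open import Data.List.Relation.Unary.Unique.Propositional using (Unique; []; _∷_)
import Data.List.Relation.Unary.Unique.Propositional.Properties as Unique
open import Data.List.Relation.Binary.Permutation.Propositional
  using (_↭_; refl; prep; swap; trans; ↭-refl; ↭-sym; ↭-trans; ↭-reflexive; ↭⇒↭ₛ)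
open import Data.List.Relation.Binary.Permutation.Propositional.Properties
  using (All-resp-↭; ∈-resp-↭; ++⁺ˡ; ++⁺ʳ; ++⁺; ++-comm; shift; shifts; ↭-length; ∷↭∷ʳ)
import Data.List.Relation.Binary.Permutation.Propositional.Properties as Perm
import Data.List.Relation.Binary.Permutation.Setoid.Properties as PermSetoid
open import Relation.Nullary using (yes; no; ¬_)
open import Relation.Binary.PropositionalEquality
  using (_≡_; _≢_; refl; sym; cong; cong₂; subst; subst₂; setoid; module ≡-Reasoning)
  renaming (trans to ≡-trans)
open import Function using (_∘_; id)

module ++-Solver {A : Set} where
  open import Algebra.Solver.CommutativeMonoid (Perm.++-commutativeMonoid {A = A}) public

Unique-↭ : ∀ {A : Set} {xs ys : List A} → xs ↭ ys → Unique xs → Unique ys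
Unique-↭ {A} p = PermSetoid.Unique-resp-↭ (setoid A) (↭⇒↭ₛ p)

Unique-++ˡ : ∀ {A : Set} (xs : List A) {ys} → Unique (xs ++ ys) → Unique xs
Unique-++ˡ [] u = []
Unique-++ˡ (x ∷ xs) (a ∷ u) = All.++⁻ˡ xs a ∷ Unique-++ˡ xs u

Unique-++ʳ : ∀ {A : Set} (xs : List A) {ys} → Unique (xs ++ ys) → Unique ys
Unique-++ʳ [] u = u
Unique-++ʳ (x ∷ xs) (a ∷ u) = Unique-++ʳ xs u

Unique-++-disjoint : ∀ {A : Set} (xs : List A) {ys} {x} → Unique (xs ++ ys) → x ∈ xs → x ∉ ys
Unique-++-disjoint (x ∷ xs) (a ∷ u) (here refl) m = All.lookup (All.++⁻ʳ xs a) m refl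
Unique-++-disjoint (x ∷ xs) (a ∷ u) (there i) m = Unique-++-disjoint xs u i m

Unique-++⁺ : ∀ {A : Set} {xs ys : List A} → Unique xs → Unique ys →
             (∀ {x} → x ∈ xs → x ∉ ys) → Unique (xs ++ ys)
Unique-++⁺ u v d = Unique.++⁺ u v (λ (p , q) → d p q)

Unique-snoc⇒∷ : ∀ {A : Set} (xs : List A) x → Unique (xs ++ [ x ]) → Unique (x ∷ xs)
Unique-snoc⇒∷ xs x = Unique-↭ (↭-sym (∷↭∷ʳ x xs))

∉⇒All≢ : ∀ {A : Set} {x : A} (xs : List A) → x ∉ xs → All (_≢ x) xs
∉⇒All≢ [] _ = []
∉⇒All≢ (y ∷ xs) n = (λ e → n (here (sym e))) ∷ ∉⇒All≢ xs (n ∘ there)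

-- the halves of a closed walk  f(as) g(b) g(bs) f(a)  entering distinct vertices
Unique-halves : ∀ {A B X : Set} (f : A → X) (g : B → X) as a bs b →
                Unique ((map f as ++ g b ∷ map g bs) ++ [ f a ]) → Unique (a ∷ as) × Unique (b ∷ bs)
Unique-halves {X = X} f g as a bs b u =
  Unique-snoc⇒∷ as a (Unique.map⁻ (subst Unique (sym (map-++ f as [ a ])) (Unique-++ˡ _ u'))) ,
  Unique.map⁻ {f = g} (Unique-++ʳ (map f as ++ [ f a ]) u')
  where
  open ++-Solver {X}
  u' : Unique ((map f as ++ [ f a ]) ++ (g b ∷ map g bs))
  u' = Unique-↭ (solve 4 (λ p y q x → (p ⊕ (y ⊕ q)) ⊕ x ⊜ (p ⊕ x) ⊕ (y ⊕ q)) ↭-refl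
                         (map f as) [ g b ] (map g bs) [ f a ]) u

Unique-around : ∀ {X : Set} (xs : List X) n ys m → Unique ((xs ++ n ∷ ys) ++ [ m ]) → Unique xs × Unique ys
Unique-around xs n ys m u = Unique-++ˡ xs u' , Unique-++ʳ [ n ] (Unique-++ʳ xs u')
  where u' = Unique-++ˡ (xs ++ n ∷ ys) u

Unique-cut : ∀ {X : Set} (xs : List X) q ys z → Unique ((xs ++ q ∷ ys) ++ [ z ]) →
             Unique ((xs ++ [ q ]) ++ [ z ]) × Unique (q ∷ ys)
Unique-cut {X} xs q ys z u =
  Unique-++ˡ ((xs ++ [ q ]) ++ [ z ])
    (Unique-↭ (solve 4 (λ a y b x → (a ⊕ (y ⊕ b)) ⊕ x ⊜ ((a ⊕ y) ⊕ x) ⊕ b) ↭-refl xs [ q ] ys [ z ]) u) ,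
  Unique-++ˡ (q ∷ ys)
    (Unique-↭ (solve 4 (λ a y b x → (a ⊕ (y ⊕ b)) ⊕ x ⊜ (y ⊕ b) ⊕ (a ⊕ x)) ↭-refl xs [ q ] ys [ z ]) u)
  where open ++-Solver {X}

concatMap-++ : ∀ {A B : Set} (f : A → List B) xs ys →
               concatMap f (xs ++ ys) ≡ concatMap f xs ++ concatMap f ys
concatMap-++ f xs ys = ≡-trans (cong concat (map-++ f xs ys)) (sym (concat-++ (map f xs) (map f ys)))

concatMap-↭ : ∀ {A B : Set} (f : A → List B) {xs ys} → xs ↭ ys → concatMap f xs ↭ concatMap f ys
concatMap-↭ f refl = ↭-refl
concatMap-↭ f (prep x p) = ++⁺ˡ (f x) (concatMap-↭ f p)
concatMap-↭ f (swap x y p) = trans (shifts (f x) (f y)) (++⁺ˡ (f y) (++⁺ˡ (f x) (concatMap-↭ f p)))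
concatMap-↭ f (trans p q) = trans (concatMap-↭ f p) (concatMap-↭ f q)

∈-concatMap⁻ : ∀ {A B : Set} (f : A → List B) xs {y} → y ∈ concatMap f xs →
               Σ A λ x → x ∈ xs × y ∈ f x
∈-concatMap⁻ f xs i with ∈-concat⁻′ (map f xs) i
... | (ys , y∈ys , ys∈) with ∈-map⁻ f ys∈
... | (x , x∈ , refl) = x , x∈ , y∈ys

∈-concatMap⁺ : ∀ {A B : Set} (f : A → List B) {xs x y} → x ∈ xs → y ∈ f x → y ∈ concatMap f xs
∈-concatMap⁺ f x∈ y∈ = ∈-concat⁺′ y∈ (∈-map⁺ f x∈)

∈⇒↭∷ : ∀ {A : Set} {xs : List A} {x} → x ∈ xs → Σ (List A) λ rest → xs ↭ x ∷ rest
∈⇒↭∷ i with ∈-∃++ i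
... | (as , bs , refl) = as ++ bs , shift _ as bs

cut-↭ : ∀ {A B : Set} (f : A → B) as x bs → map f (as ++ x ∷ bs) ↭ map f (bs ++ as) ++ [ f x ]
cut-↭ {B = B} f as x bs rewrite map-++ f as (x ∷ bs) | map-++ f bs as =
  solve 3 (λ a y b → a ⊕ (y ⊕ b) ⊜ (b ⊕ a) ⊕ y) ↭-refl (map f as) [ f x ] (map f bs)
  where open ++-Solver {B}

pivot-↭ : ∀ {A B : Set} (f : A → B) d ys zs → (map f ys ++ [ d ]) ++ map f zs ↭ d ∷ map f (ys ++ zs)
pivot-↭ {B = B} f d ys zs rewrite map-++ f ys zs =
  solve 3 (λ a y b → (a ⊕ y) ⊕ b ⊜ y ⊕ (a ⊕ b)) ↭-refl (map f ys) [ d ] (map f zs)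
  where open ++-Solver {B}

-- A cycle
-- decomposition of G is a list of cycles whose edge lists concatenate to an enumeration
-- of the edges: IsDecomposition G cs = Enumerates (nE G) (concatMap cycleEdges cs).

Enumerates : (n : ℕ) → List (Fin n) → Set
Enumerates n xs = Unique xs × (∀ i → i ∈ xs)

Enumerates-↭ : ∀ {n xs ys} → xs ↭ ys → Enumerates n xs → Enumerates n ys
Enumerates-↭ p (u , c) = Unique-↭ p u , λ i → ∈-resp-↭ p (c i)

allFin-enumerates : ∀ n → Enumerates n (allFin n)
allFin-enumerates n = Unique.allFin⁺ n , ∈-allFin

↑ˡ≢↑ʳ : ∀ {m n} (a : Fin m) (b : Fin n) → a ↑ˡ n ≢ m ↑ʳ b
↑ˡ≢↑ʳ {m} {n} a b e with cong (splitAt m) e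
... | h rewrite splitAt-↑ˡ m a n | splitAt-↑ʳ m n b = inj₁≢inj₂ h
  where inj₁≢inj₂ : ∀ {a' : Fin m} {b' : Fin n} → inj₁ a' ≢ inj₂ b'
        inj₁≢inj₂ ()

inj-∈ : ∀ {A B : Set} {f : A → B} → (∀ {x y} → f x ≡ f y → x ≡ y) → ∀ {x xs} → f x ∈ map f xs → x ∈ xs
inj-∈ inj m with ∈-map⁻ _ m
... | (y , y∈ , e) rewrite inj e = y∈

Unique-sum⁺ : ∀ {m n} {xs : List (Fin m)} {ys : List (Fin n)} → Unique xs → Unique ys →
              Unique (map (_↑ˡ n) xs ++ map (m ↑ʳ_) ys)
Unique-sum⁺ {m} {n} {xs} {ys} u v =
  Unique-++⁺ (Unique.map⁺ (↑ˡ-injective n _ _) u) (Unique.map⁺ (↑ʳ-injective m _ _) v) disjoint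
  where
  disjoint : ∀ {z} → z ∈ map (_↑ˡ n) xs → z ∉ map (m ↑ʳ_) ys
  disjoint p q with ∈-map⁻ (_↑ˡ n) p | ∈-map⁻ (m ↑ʳ_) q
  ... | (a , _ , refl) | (b , _ , e) = ↑ˡ≢↑ʳ a b e

Enumerates-sum⁺ : ∀ {m n xs ys} → Enumerates m xs → Enumerates n ys →
                  Enumerates (m + n) (map (_↑ˡ n) xs ++ map (m ↑ʳ_) ys)
Enumerates-sum⁺ {m} {n} {xs} {ys} (u , c) (v , d) = Unique-sum⁺ u v , cover
  where
  cover : ∀ i → i ∈ map (_↑ˡ n) xs ++ map (m ↑ʳ_) ys
  cover i with splitAt m i | join-splitAt m n i
  ... | inj₁ a | refl = ∈-++⁺ˡ (∈-map⁺ _ (c a))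
  ... | inj₂ b | refl = ∈-++⁺ʳ _ (∈-map⁺ _ (d b))

Enumerates-sum⁻ : ∀ {m n xs ys} → Enumerates (m + n) (map (_↑ˡ n) xs ++ map (m ↑ʳ_) ys) →
                  Enumerates m xs × Enumerates n ys
Enumerates-sum⁻ {m} {n} {xs} {ys} (u , c) =
  (Unique.map⁻ (Unique-++ˡ _ u) , λ a → left a (∈-++⁻ _ (c (a ↑ˡ n)))) ,
  (Unique.map⁻ (Unique-++ʳ (map (_↑ˡ n) xs) u) , λ b → right b (∈-++⁻ _ (c (m ↑ʳ b))))
  where
  left : ∀ a → (a ↑ˡ n ∈ map (_↑ˡ n) xs) ⊎ (a ↑ˡ n ∈ map (m ↑ʳ_) ys) → a ∈ xs
  left a (inj₁ p) = inj-∈ (↑ˡ-injective n _ _) p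
  left a (inj₂ p) with ∈-map⁻ _ p
  ... | (b , _ , e) = ⊥-elim (↑ˡ≢↑ʳ a b e)
  right : ∀ b → (m ↑ʳ b ∈ map (_↑ˡ n) xs) ⊎ (m ↑ʳ b ∈ map (m ↑ʳ_) ys) → b ∈ ys
  right b (inj₂ p) = inj-∈ (↑ʳ-injective m _ _) p
  right b (inj₁ p) with ∈-map⁻ _ p
  ... | (a , _ , e) = ⊥-elim (↑ˡ≢↑ʳ a b (sym e))

delEdge-injective : ∀ {m} (d : Fin m) {i j} → delEdge d i ≡ delEdge d j → i ≡ j
delEdge-injective {suc _} d = punchIn-injective d _ _

delEdge-≢ : ∀ {m} (d : Fin m) i → delEdge d i ≢ d
delEdge-≢ {suc _} d = punchInᵢ≢i d

delEdge-onto : ∀ {m} (d : Fin m) e → e ≢ d → Σ (Fin (pred m)) λ i → delEdge d i ≡ e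
delEdge-onto {suc _} d e e≢d = punchOut (λ d≡e → e≢d (sym d≡e)) , punchIn-punchOut _

delEdge-∉ : ∀ {m} (d : Fin m) xs → d ∉ map (delEdge d) xs
delEdge-∉ d xs m with ∈-map⁻ (delEdge d) m
... | (j , _ , e) = delEdge-≢ d j (sym e)

Enumerates-del⁺ : ∀ {m xs} (d : Fin m) → Enumerates (pred m) xs → Enumerates m (d ∷ map (delEdge d) xs)
Enumerates-del⁺ {m} {xs} d (u , c) =
  (All.tabulate (λ i∈ d≡ → delEdge-∉ d xs (subst (_∈ map (delEdge d) xs) (sym d≡) i∈)) ∷
     Unique.map⁺ (delEdge-injective d) u) , cover
  where
  cover : ∀ i → i ∈ d ∷ map (delEdge d) xs
  cover i with d ≟ i
  ... | yes refl = here refl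
  ... | no d≢i with delEdge-onto d i (λ e → d≢i (sym e))
  ...   | (j , refl) = there (∈-map⁺ _ (c j))

Enumerates-del⁻ : ∀ {m xs} (d : Fin m) → Enumerates m (d ∷ map (delEdge d) xs) → Enumerates (pred m) xs
Enumerates-del⁻ d (_ ∷ u , c) = Unique.map⁻ u , λ i → back i (c (delEdge d i))
  where
  back : ∀ i → delEdge d i ∈ d ∷ map (delEdge d) _ → i ∈ _
  back i (here e) = ⊥-elim (delEdge-≢ d i e)
  back i (there m) = inj-∈ (delEdge-injective d) m

Step : Graph → Set
Step G = Fin (nE G) × Fin (nV G)

vsOf : ∀ {A B : Set} → List (A × B) → List B
vsOf = map proj₂

esOf : ∀ {A B : Set} → List (A × B) → List A
esOf = map proj₁

Joins-sym : ∀ {G e x y} → Joins G e x y → Joins G e y x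
Joins-sym (inj₁ p) = inj₂ p
Joins-sym (inj₂ p) = inj₁ p

walk-++ : ∀ {G x y z} (A : List (Step G)) {B} →
          WalkFromTo G x A y → WalkFromTo G y B z → WalkFromTo G x (A ++ B) z
walk-++ [] refl w = w
walk-++ ((e , z) ∷ A) (j , w) w' = j , walk-++ A w w'

walk-split : ∀ {G x z} (A : List (Step G)) {B} → WalkFromTo G x (A ++ B) z →
             Σ (Fin (nV G)) λ y → WalkFromTo G x A y × WalkFromTo G y B z
walk-split [] w = _ , refl , w
walk-split ((e , z) ∷ A) (j , w) with walk-split A w
... | (y , w₁ , w₂) = y , (j , w₁) , w₂

walk-nonempty : ∀ {G x y} (A : List (Step G)) → WalkFromTo G x A y → x ≢ y → A ≢ []
walk-nonempty [] w x≢y refl = x≢y w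
walk-nonempty (_ ∷ _) _ _ ()

reverseWalk : (G : Graph) → Fin (nV G) → List (Step G) → List (Step G)
reverseWalk G x [] = []
reverseWalk G x ((e , z) ∷ st) = reverseWalk G z st ++ [ (e , x) ]

reverseWalk-walk : ∀ {G x y} (st : List (Step G)) → WalkFromTo G x st y →
                   WalkFromTo G y (reverseWalk G x st) x
reverseWalk-walk [] refl = refl
reverseWalk-walk {G} ((e , z) ∷ st) (j , w) =
  walk-++ (reverseWalk G z st) (reverseWalk-walk st w) (Joins-sym {G} j , refl)

reverseWalk-edges : ∀ {G} x (st : List (Step G)) → esOf (reverseWalk G x st) ↭ esOf st
reverseWalk-edges x [] = ↭-refl
reverseWalk-edges {G} x ((e , z) ∷ st) =
  ↭-trans (↭-reflexive (map-++ proj₁ (reverseWalk G z st) [ (e , x) ]))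
    (↭-trans (↭-sym (∷↭∷ʳ e (esOf (reverseWalk G z st)))) (prep e (reverseWalk-edges z st)))

reverseWalk-vertices : ∀ {G x y} (st : List (Step G)) → WalkFromTo G x st y →
                       y ∷ vsOf (reverseWalk G x st) ↭ x ∷ vsOf st
reverseWalk-vertices [] refl = ↭-refl
reverseWalk-vertices {G} {x} {y} ((e , z) ∷ st) (j , w) =
  ↭-trans (prep y (↭-reflexive (map-++ proj₂ (reverseWalk G z st) [ (e , x) ])))
    (↭-trans (prep y (↭-sym (∷↭∷ʳ x (vsOf (reverseWalk G z st)))))
      (↭-trans (swap y x ↭-refl) (prep x (reverseWalk-vertices st w))))

rotate : ∀ {G} (C : Cycle G) (A B : List (Step G)) → Cycle.steps C ≡ A ++ B →
         Σ (Cycle G) λ C' → (Cycle.steps C' ≡ B ++ A) × (cycleEdges C' ↭ cycleEdges C)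
rotate {G} (cycle s st cl l2 dv de) A B refl with walk-split A cl
... | (y , w₁ , w₂) =
  cycle y (B ++ A) (walk-++ B w₂ w₁) (subst (2 ≤_) length-swap l2)
        (Unique-↭ (swap-↭ proj₂) dv) (Unique-↭ (swap-↭ proj₁) de) , refl , ↭-sym (swap-↭ proj₁)
  where
  swap-↭ : ∀ {X : Set} (f : Step G → X) → map f (A ++ B) ↭ map f (B ++ A)
  swap-↭ f rewrite map-++ f A B | map-++ f B A = ++-comm (map f A) (map f B)
  length-swap : length (A ++ B) ≡ length (B ++ A)
  length-swap rewrite length-++ A {B} | length-++ B {A} = +-comm (length A) (length B)

record CutAt (G : Graph) (d : Fin (nE G)) (C : Cycle G) : Set where
  constructor cut
  field
    from to   : Fin (nV G)
    path      : List (Step G)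
    walk      : WalkFromTo G from path to
    closing   : Joins G d to from
    distinctV : Unique (vsOf path ++ [ from ])
    distinctE : Unique (esOf path ++ [ d ])
    edges     : esOf path ++ [ d ] ↭ cycleEdges C

cutAt : ∀ {G} (C : Cycle G) {d} → d ∈ cycleEdges C → CutAt G d C
cutAt {G} (cycle s st cl _ dv de) {d} d∈ with ∈-map⁻ proj₁ d∈
... | ((.d , z) , z∈ , refl) with ∈-∃++ z∈
... | (A , B , refl) with walk-split A cl
... | (t , wA , (j , wB)) =
  cut z t (B ++ A) (walk-++ B wB wA) j
      (Unique-↭ (cut-↭ proj₂ A (d , z) B) dv) (Unique-↭ (cut-↭ proj₁ A (d , z) B) de)
      (↭-sym (cut-↭ proj₁ A (d , z) B))

record Embedding (H G : Graph) : Set where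
  field
    fV   : Fin (nV H) → Fin (nV G)
    fE   : Fin (nE H) → Fin (nE G)
    comm : ∀ e → ends G (fE e) ≡ mapP fV fV (ends H e)
    injV : ∀ {x y} → fV x ≡ fV y → x ≡ y
    injE : ∀ {x y} → fE x ≡ fE y → x ≡ y

InIm : ∀ {H G} → Embedding H G → Fin (nE G) → Set
InIm h e = Σ _ λ e' → Embedding.fE h e' ≡ e

module EmbeddingOps {H G : Graph} (h : Embedding H G) where
  open Embedding h

  mapSt : List (Step H) → List (Step G)
  mapSt = map (mapP fE fV)

  vs-map : ∀ st → vsOf (mapSt st) ≡ map fV (vsOf st)
  vs-map st = ≡-trans (sym (map-∘ st)) (map-∘ st)

  es-map : ∀ st → esOf (mapSt st) ≡ map fE (esOf st)
  es-map st = ≡-trans (sym (map-∘ st)) (map-∘ st)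

  joins-map : ∀ {e x z} → Joins H e x z → Joins G (fE e) (fV x) (fV z)
  joins-map {e} (inj₁ p) = inj₁ (≡-trans (comm e) (cong (mapP fV fV) p))
  joins-map {e} (inj₂ p) = inj₂ (≡-trans (comm e) (cong (mapP fV fV) p))

  walk-map : ∀ {x y} st → WalkFromTo H x st y → WalkFromTo G (fV x) (mapSt st) (fV y)
  walk-map [] refl = refl
  walk-map ((e , z) ∷ st) (j , w) = joins-map j , walk-map st w

  mapCycle : Cycle H → Cycle G
  mapCycle (cycle s st cl l2 dv de) =
    cycle (fV s) (mapSt st) (walk-map st cl) (subst (2 ≤_) (sym (length-map _ st)) l2)
      (subst Unique (sym (vs-map st)) (Unique.map⁺ injV dv))
      (subst Unique (sym (es-map st)) (Unique.map⁺ injE de))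

  concat-mapCycle : ∀ cs → concatMap cycleEdges (map mapCycle cs) ≡ map fE (concatMap cycleEdges cs)
  concat-mapCycle [] = refl
  concat-mapCycle (C@(cycle _ st _ _ _ _) ∷ cs) rewrite es-map st | concat-mapCycle cs =
    sym (map-++ fE (cycleEdges C) _)

  incident : ∀ {e' x z} → Joins G (fE e') x z → (Σ _ λ a → x ≡ fV a) × (Σ _ λ b → z ≡ fV b)
  incident {e'} (inj₁ p) = let q = ≡-trans (sym p) (comm e') in
    (proj₁ (ends H e') , cong proj₁ q) , (proj₂ (ends H e') , cong proj₂ q)
  incident {e'} (inj₂ p) = let q = ≡-trans (sym p) (comm e') in
    (proj₂ (ends H e') , cong proj₂ q) , (proj₁ (ends H e') , cong proj₁ q)

  joins-pull : ∀ {e' x z} → Joins G (fE e') (fV x) z → Σ _ λ b → (z ≡ fV b) × Joins H e' x b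
  joins-pull {e'} (inj₁ p) = let q = ≡-trans (sym p) (comm e') in
    proj₂ (ends H e') , cong proj₂ q , inj₁ (cong (_, proj₂ (ends H e')) (injV (sym (cong proj₁ q))))
  joins-pull {e'} (inj₂ p) = let q = ≡-trans (sym p) (comm e') in
    proj₁ (ends H e') , cong proj₁ q , inj₂ (cong (proj₁ (ends H e') ,_) (injV (sym (cong proj₂ q))))

  walk-pull : ∀ {x y} st → WalkFromTo G (fV x) st y → All (InIm h ∘ proj₁) st →
              Σ (List (Step H)) λ st' → (st ≡ mapSt st') × Σ _ λ y' → (y ≡ fV y') × WalkFromTo H x st' y'
  walk-pull {x} [] refl [] = [] , refl , x , refl , refl
  walk-pull ((e , z) ∷ st) (j , w) ((e' , refl) ∷ a) with joins-pull j
  ... | (b , refl , j') with walk-pull st w a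
  ... | (st' , refl , y' , refl , w') = (e' , b) ∷ st' , refl , y' , refl , j' , w'

  Pulled : Fin (nV G) → List (Step G) → Fin (nV G) → Set
  Pulled z P t = Σ _ λ a → Σ _ λ b → Σ (List (Step H)) λ W →
                 (z ≡ fV a) × (t ≡ fV b) × (P ≡ mapSt W) × WalkFromTo H a W b

  walk-pull⁺ : ∀ {z t} P → WalkFromTo G z P t → All (InIm h ∘ proj₁) P → P ≢ [] → Pulled z P t
  walk-pull⁺ [] w a ne = ⊥-elim (ne refl)
  walk-pull⁺ ((e , x) ∷ P) w ((e' , refl) ∷ a) ne with proj₁ (incident (proj₁ w))
  ... | (a₀ , refl) with walk-pull ((e , x) ∷ P) w ((e' , refl) ∷ a)
  ... | (W , eq , y' , y≡ , w') = a₀ , y' , W , refl , y≡ , eq , w'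

  cycle-pull : (C : Cycle G) → All (InIm h ∘ proj₁) (Cycle.steps C) →
               Σ (Cycle H) λ C' → Cycle.steps C ≡ mapSt (Cycle.steps C')
  cycle-pull (cycle s [] cl () dv de) a
  cycle-pull (cycle s ((e , z) ∷ st) cl l2 dv de) ((e' , refl) ∷ a) with incident (proj₁ cl)
  ... | ((s' , refl) , _) with walk-pull ((e , z) ∷ st) cl ((e' , refl) ∷ a)
  ... | (st' , eq , y' , y≡ , w') with injV y≡
  ... | refl = cycle s' st' w' (subst (2 ≤_) (≡-trans (cong length eq) (length-map _ st')) l2)
       (Unique.map⁻ (subst Unique (≡-trans (cong vsOf eq) (vs-map st')) dv))
       (Unique.map⁻ (subst Unique (≡-trans (cong esOf eq) (es-map st')) de)) , eq

  cycle-pull-edges : (C : Cycle G) → All (InIm h ∘ proj₁) (Cycle.steps C) →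
                     Σ (Cycle H) λ C' → cycleEdges C ≡ map fE (cycleEdges C')
  cycle-pull-edges C a with cycle-pull C a
  ... | (C' , eq) = C' , ≡-trans (cong esOf eq) (es-map (Cycle.steps C'))

concat-pushTwo : ∀ {H1 H2 G} (h1 : Embedding H1 G) (h2 : Embedding H2 G) cs1 cs2 →
  concatMap cycleEdges (map (EmbeddingOps.mapCycle h1) cs1 ++ map (EmbeddingOps.mapCycle h2) cs2) ≡
  map (Embedding.fE h1) (concatMap cycleEdges cs1) ++ map (Embedding.fE h2) (concatMap cycleEdges cs2)
concat-pushTwo h1 h2 cs1 cs2 =
  ≡-trans (concatMap-++ cycleEdges (map (EmbeddingOps.mapCycle h1) cs1) _)
    (cong₂ _++_ (EmbeddingOps.concat-mapCycle h1 cs1) (EmbeddingOps.concat-mapCycle h2 cs2))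

length-pushTwo : ∀ {H1 H2 G} (h1 : Embedding H1 G) (h2 : Embedding H2 G) cs1 cs2 →
  length (map (EmbeddingOps.mapCycle h1) cs1 ++ map (EmbeddingOps.mapCycle h2) cs2) ≡ length cs1 + length cs2
length-pushTwo h1 h2 cs1 cs2 =
  ≡-trans (length-++ (map (EmbeddingOps.mapCycle h1) cs1)) (cong₂ _+_ (length-map _ cs1) (length-map _ cs2))

-- Deleting an edge d: cycles of G through d correspond to paths of G − d joining the
-- two ends of d.

delG : (G : Graph) → Fin (nE G) → Graph
delG G d = graph (nV G) (pred (nE G)) (λ i → ends G (delEdge d i))

delEmbedding : (G : Graph) (d : Fin (nE G)) → Embedding (delG G d) G
delEmbedding G d = record
  { fV = id ; fE = delEdge d ; comm = λ _ → refl ; injV = id ; injE = delEdge-injective d }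

avoiding : ∀ G d (st : List (Step G)) → d ∉ esOf st → All (InIm (delEmbedding G d) ∘ proj₁) st
avoiding G d st d∉ =
  All.map (λ {x} x≢d → delEdge-onto d (proj₁ x) x≢d) (All.map⁻ (∉⇒All≢ (esOf st) d∉))

endUV : ∀ (G : Graph) e s → Joins G e (endU G e s) (endV G e s)
endUV G e true = inj₁ refl
endUV G e false = inj₂ refl

endUV-cases : ∀ (G : Graph) e s {x y} → Joins G e x y →
  (endU G e s ≡ x × endV G e s ≡ y) ⊎ (endU G e s ≡ y × endV G e s ≡ x)
endUV-cases G e true (inj₁ p) = inj₁ (cong proj₁ p , cong proj₂ p)
endUV-cases G e true (inj₂ p) = inj₂ (cong proj₁ p , cong proj₂ p)
endUV-cases G e false (inj₁ p) = inj₂ (cong proj₂ p , cong proj₁ p)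
endUV-cases G e false (inj₂ p) = inj₁ (cong proj₂ p , cong proj₁ p)

joins-ends : ∀ {G e a b x y} → ends G e ≡ (a , b) → Joins G e x y → (x ≡ a × y ≡ b) ⊎ (x ≡ b × y ≡ a)
joins-ends eq (inj₁ p) = let q = ≡-trans (sym p) eq in inj₁ (cong proj₁ q , cong proj₂ q)
joins-ends eq (inj₂ p) = let q = ≡-trans (sym p) eq in inj₂ (cong proj₂ q , cong proj₁ q)

endU-not : ∀ (G : Graph) e s → endU G e (not s) ≡ endV G e s
endU-not G e true = refl
endU-not G e false = refl

endV-not : ∀ (G : Graph) e s → endV G e (not s) ≡ endU G e s
endV-not G e true = refl
endV-not G e false = refl

endUV-≢ : ∀ (G : Graph) → Loopless G → ∀ e s → endU G e s ≢ endV G e s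
endUV-≢ G ll e true = ll e
endUV-≢ G ll e false = ll e ∘ sym

snoc-length : ∀ {A : Set} (xs : List A) y → 1 ≤ length (xs ++ [ y ])
snoc-length [] y = s≤s z≤n
snoc-length (_ ∷ _) y = s≤s z≤n

pathToCycle : ∀ (G : Graph) (d : Fin (nE G)) {a b} (W : List (Step (delG G d))) →
  WalkFromTo (delG G d) a W b → Joins G d b a → a ≢ b → Unique (a ∷ vsOf W) → Unique (esOf W) →
  Σ (Cycle G) λ C → cycleEdges C ≡ map (delEdge d) (esOf W) ++ [ d ]
pathToCycle G d [] refl j a≢b _ _ = ⊥-elim (a≢b refl)
pathToCycle G d {a} (st ∷ W) w j _ (a∉ ∷ dv) de =
  cycle a (mapSt (st ∷ W) ++ [ (d , a) ]) (walk-++ (mapSt (st ∷ W)) (walk-map (st ∷ W) w) (j , refl))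
        (s≤s (snoc-length (mapSt W) _)) distinctV distinctE , edges
  where
  open EmbeddingOps (delEmbedding G d)
  edges : esOf (mapSt (st ∷ W) ++ [ (d , a) ]) ≡ map (delEdge d) (esOf (st ∷ W)) ++ [ d ]
  edges = ≡-trans (map-++ proj₁ (mapSt (st ∷ W)) _) (cong (_++ [ d ]) (es-map (st ∷ W)))
  vertices : vsOf (mapSt (st ∷ W) ++ [ (d , a) ]) ≡ vsOf (st ∷ W) ++ [ a ]
  vertices = ≡-trans (map-++ proj₂ (mapSt (st ∷ W)) _) (cong (_++ [ a ]) (≡-trans (vs-map (st ∷ W)) (map-id _)))
  distinctV : Unique (vsOf (mapSt (st ∷ W) ++ [ (d , a) ]))
  distinctV = subst Unique (sym vertices) (Unique-↭ (∷↭∷ʳ a (vsOf (st ∷ W))) (a∉ ∷ dv))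
  distinctE : Unique (esOf (mapSt (st ∷ W) ++ [ (d , a) ]))
  distinctE = subst Unique (sym edges)
    (Unique-++⁺ (Unique.map⁺ (delEdge-injective d) de) ([] ∷ []) λ { m (here refl) → delEdge-∉ d _ m })

record PathAround (G : Graph) (d : Fin (nE G)) (s : Bool) (C : Cycle G) : Set where
  constructor around
  field
    path      : List (Step (delG G d))
    walk      : WalkFromTo (delG G d) (endU G d s) path (endV G d s)
    distinctV : Unique (endU G d s ∷ vsOf path)
    edges     : map (delEdge d) (esOf path) ++ [ d ] ↭ cycleEdges C

orientPath : ∀ (G : Graph) d s {C : Cycle G} {z t} (W : List (Step (delG G d))) →
  WalkFromTo (delG G d) z W t → Unique (z ∷ vsOf W) → map (delEdge d) (esOf W) ++ [ d ] ↭ cycleEdges C →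
  (endU G d s ≡ z × endV G d s ≡ t) ⊎ (endU G d s ≡ t × endV G d s ≡ z) → PathAround G d s C
orientPath G d s W w dv edges (inj₁ (refl , refl)) = around W w dv edges
orientPath G d s {z = z} W w dv edges (inj₂ (refl , refl)) =
  around (reverseWalk _ z W) (reverseWalk-walk W w) (Unique-↭ (↭-sym (reverseWalk-vertices W w)) dv)
         (↭-trans (++⁺ʳ [ d ] (Perm.map⁺ (delEdge d) (reverseWalk-edges z W))) edges)

cycleToPath : (G : Graph) (d : Fin (nE G)) (C : Cycle G) → d ∈ cycleEdges C → (s : Bool) → PathAround G d s C
cycleToPath G d C d∈C s with cutAt C d∈C
... | cut z t P wP j dv de edgesP
    with EmbeddingOps.walk-pull (delEmbedding G d) {x = z} P wP
           (avoiding G d P (λ m → Unique-++-disjoint (esOf P) de m (here refl)))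
... | (W , refl , .t , refl , wW) =
  orientPath G d s W wW dvW (subst (λ l → l ++ [ d ] ↭ cycleEdges C) (es-map W) edgesP)
    (endUV-cases G d s (Joins-sym {G} j))
  where
  open EmbeddingOps (delEmbedding G d)
  dvW : Unique (z ∷ vsOf W)
  dvW = Unique-snoc⇒∷ (vsOf W) z (subst (λ l → Unique (l ++ [ z ])) (≡-trans (vs-map W) (map-id _)) dv)

pullBackAvoiding : ∀ (G : Graph) (d : Fin (nE G)) (cs : List (Cycle G)) → d ∉ concatMap cycleEdges cs →
  Σ (List (Cycle (delG G d))) λ cs' →
    (concatMap cycleEdges cs ≡ map (delEdge d) (concatMap cycleEdges cs')) × (length cs ≡ length cs')
pullBackAvoiding G d [] _ = [] , refl , refl
pullBackAvoiding G d (C ∷ cs) d∉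
  with pullBackAvoiding G d cs (d∉ ∘ ∈-++⁺ʳ (cycleEdges C))
     | EmbeddingOps.cycle-pull-edges (delEmbedding G d) C (avoiding G d (Cycle.steps C) (d∉ ∘ ∈-++⁺ˡ))
... | (cs' , eq , len) | (C' , edges≡) =
  C' ∷ cs' , ≡-trans (cong₂ _++_ edges≡ eq) (sym (map-++ (delEdge d) (cycleEdges C') _)) , cong suc len

record Detached (G : Graph) (d : Fin (nE G)) (cs : List (Cycle G)) : Set where
  constructor detached
  field
    cyc     : Cycle G
    others  : List (Cycle G)
    through : d ∈ cycleEdges cyc
    perm    : cs ↭ cyc ∷ others
    enum    : Enumerates (nE G) (cycleEdges cyc ++ concatMap cycleEdges others)

detach : ∀ {G} cs → IsDecomposition G cs → (d : Fin (nE G)) → Detached G d cs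
detach cs dc d with ∈-concatMap⁻ cycleEdges cs (proj₂ dc d)
... | (C , C∈ , d∈) with ∈⇒↭∷ C∈
... | (others , p) = detached C others d∈ p (Enumerates-↭ (concatMap-↭ cycleEdges p) dc)

record OpenDecomposition (G : Graph) (d : Fin (nE G)) (s : Bool) (m : ℕ) : Set where
  constructor opened
  field
    path      : List (Step (delG G d))
    walk      : WalkFromTo (delG G d) (endU G d s) path (endV G d s)
    distinctV : Unique (endU G d s ∷ vsOf path)
    rest      : List (Cycle (delG G d))
    enum      : Enumerates (pred (nE G)) (esOf path ++ concatMap cycleEdges rest)
    size      : m ≡ suc (length rest)

openDecomposition : ∀ G d s cs → IsDecomposition G cs → OpenDecomposition G d s (length cs)
openDecomposition G d s cs dc with detach cs dc d
... | detached C others d∈ p en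
    with cycleToPath G d C d∈ s | pullBackAvoiding G d others (Unique-++-disjoint (cycleEdges C) (proj₁ en) d∈)
... | around W wW dvW edgesW | (rest , eq , len) =
  opened W wW dvW rest (Enumerates-del⁻ d (Enumerates-↭ reorder en)) (≡-trans (↭-length p) (cong suc len))
  where
  reorder : cycleEdges C ++ concatMap cycleEdges others ↭ d ∷ map (delEdge d) (esOf W ++ concatMap cycleEdges rest)
  reorder = ↭-trans (++⁺ (↭-sym edgesW) (↭-reflexive eq)) (pivot-↭ (delEdge d) d (esOf W) (concatMap cycleEdges rest))

closeDecomposition : ∀ G d (D : Cycle G) Y → cycleEdges D ≡ map (delEdge d) Y ++ [ d ] →
  (R : List (Cycle (delG G d))) → Enumerates (pred (nE G)) (Y ++ concatMap cycleEdges R) →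
  IsDecomposition G (D ∷ map (EmbeddingOps.mapCycle (delEmbedding G d)) R)
closeDecomposition G d D Y eD R en = Enumerates-↭ (↭-sym reorder) (Enumerates-del⁺ d en)
  where
  open EmbeddingOps (delEmbedding G d)
  reorder : cycleEdges D ++ concatMap cycleEdges (map mapCycle R) ↭ d ∷ map (delEdge d) (Y ++ concatMap cycleEdges R)
  reorder rewrite eD | concat-mapCycle R = pivot-↭ (delEdge d) d Y (concatMap cycleEdges R)

-- Some ("old") edges of G are coloured: colour true means the
-- edge comes from H1, colour false that it comes from H2.  If two old edges of
-- different colours can only meet at a vertex satisfying J, then a walk of old edges
-- whose inner vertices avoid J is monochromatic, i.e. lies in H1 or in H2.

module TwoSided (G H1 H2 : Graph) (h1 : Embedding H1 G) (h2 : Embedding H2 G)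
  (Old : Fin (nE G) → Set) (col : Fin (nE G) → Bool)
  (colT : ∀ e → Old e → col e ≡ true → InIm h1 e)
  (colF : ∀ e → Old e → col e ≡ false → InIm h2 e) where

  private
    module E1 = EmbeddingOps h1
    module E2 = EmbeddingOps h2

  ColourChange : (Fin (nV G) → Set) → Set
  ColourChange J = ∀ {e e' x y z} → Old e → Old e' → Joins G e x z → Joins G e' z y → col e ≢ col e' → J z

  SidesMeetIn : (Fin (nV G) → Set) → Set
  SidesMeetIn J = ∀ {e e' x y z} → InIm h1 e → InIm h2 e' → Joins G e x z → Joins G e' z y → J z

  colourChange : ∀ {J} → SidesMeetIn J → ColourChange J
  colourChange meet {e} {e'} o o' j j' ne with col e in ce | col e' in ce'
  ... | true  | true  = ⊥-elim (ne refl)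
  ... | false | false = ⊥-elim (ne refl)
  ... | true  | false = meet (colT e o ce) (colF e' o' ce') j j'
  ... | false | true  = meet (colT e' o' ce') (colF e o ce) (Joins-sym {G} j') (Joins-sym {G} j)

  inH1 : ∀ (P : List (Step G)) → All (Old ∘ proj₁) P → All (λ s → col (proj₁ s) ≡ true) P →
         All (InIm h1 ∘ proj₁) P
  inH1 P o c = All.zipWith (λ { {s} (p , q) → colT (proj₁ s) p q }) (o , c)

  inH2 : ∀ (P : List (Step G)) → All (Old ∘ proj₁) P → All (λ s → col (proj₁ s) ≡ false) P →
         All (InIm h2 ∘ proj₁) P
  inH2 P o c = All.zipWith (λ { {s} (p , q) → colF (proj₁ s) p q }) (o , c)

  module Avoiding (J : Fin (nV G) → Set) (change : ColourChange J) where

    AvoidInner : List (Step G) → Set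
    AvoidInner [] = ⊤
    AvoidInner (s ∷ []) = ⊤
    AvoidInner (s ∷ s' ∷ r) = ¬ J (proj₂ s) × AvoidInner (s' ∷ r)

    avoid-all : ∀ st → All (λ s → ¬ J (proj₂ s)) st → AvoidInner st
    avoid-all [] _ = tt
    avoid-all (s ∷ []) _ = tt
    avoid-all (s ∷ s' ∷ r) (p ∷ a) = p , avoid-all (s' ∷ r) a

    avoid-snoc : ∀ st t → All (λ s → ¬ J (proj₂ s)) st → AvoidInner (st ++ [ t ])
    avoid-snoc [] t _ = tt
    avoid-snoc (s ∷ []) t (p ∷ _) = p , tt
    avoid-snoc (s ∷ s' ∷ r) t (p ∷ a) = p , avoid-snoc (s' ∷ r) t a

    monochromatic : ∀ {x y e z} rest → WalkFromTo G x ((e , z) ∷ rest) y → All (Old ∘ proj₁) ((e , z) ∷ rest) →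
                    AvoidInner ((e , z) ∷ rest) → All (λ s → col (proj₁ s) ≡ col e) ((e , z) ∷ rest)
    monochromatic [] _ _ _ = refl ∷ []
    monochromatic {e = e} ((e' , z') ∷ r) (j , j' , w) (o ∷ o' ∷ os) (z∉J , a) with col e ≟B col e'
    ... | no ne = ⊥-elim (z∉J (change o o' j j' ne))
    ... | yes eq = refl ∷ All.map (λ q → ≡-trans q (sym eq)) (monochromatic r (j' , w) (o' ∷ os) a)

    walk-side : ∀ {z t} P → P ≢ [] → WalkFromTo G z P t → All (Old ∘ proj₁) P → AvoidInner P →
                E1.Pulled z P t ⊎ E2.Pulled z P t
    walk-side [] ne _ _ _ = ⊥-elim (ne refl)
    walk-side ((e , x) ∷ P) ne w o av with monochromatic P w o av | col e in ce
    ... | m | true  = inj₁ (E1.walk-pull⁺ _ w (inH1 _ o (All.map (λ q → ≡-trans q ce) m)) ne)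
    ... | m | false = inj₂ (E2.walk-pull⁺ _ w (inH2 _ o (All.map (λ q → ≡-trans q ce) m)) ne)

  module Classify (w : Fin (nV G)) (change : ColourChange (_≡ w)) where
    open Avoiding (_≡ w) change

    InSide : Cycle G → Set
    InSide C = (Σ (Cycle H1) λ C1 → cycleEdges C ↭ map (Embedding.fE h1) (cycleEdges C1)) ⊎
               (Σ (Cycle H2) λ C2 → cycleEdges C ↭ map (Embedding.fE h2) (cycleEdges C2))

    InSide-↭ : ∀ {C C'} → cycleEdges C' ↭ cycleEdges C → InSide C' → InSide C
    InSide-↭ p (inj₁ (C1 , q)) = inj₁ (C1 , ↭-trans (↭-sym p) q)
    InSide-↭ p (inj₂ (C2 , q)) = inj₂ (C2 , ↭-trans (↭-sym p) q)

    classifyAvoiding : (C : Cycle G) → All Old (cycleEdges C) → AvoidInner (Cycle.steps C) → InSide C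
    classifyAvoiding (cycle s [] cl () dv de) o a
    classifyAvoiding C@(cycle s ((e , z) ∷ st) cl l2 dv de) o a
      with monochromatic st cl (All.map⁻ o) a | col e in ce
    ... | m | true with E1.cycle-pull-edges C (inH1 _ (All.map⁻ o) (All.map (λ q → ≡-trans q ce) m))
    ...   | (C1 , edges≡) = inj₁ (C1 , ↭-reflexive edges≡)
    classifyAvoiding C@(cycle s ((e , z) ∷ st) cl l2 dv de) o a | m | false
      with E2.cycle-pull-edges C (inH2 _ (All.map⁻ o) (All.map (λ q → ≡-trans q ce) m))
    ...   | (C2 , edges≡) = inj₂ (C2 , ↭-reflexive edges≡)

    rotateTo : (C : Cycle G) → w ∈ vsOf (Cycle.steps C) →
      Σ (Cycle G) λ C' → (cycleEdges C' ↭ cycleEdges C) ×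
        Σ (List (Step G)) λ P → Σ (Fin (nE G)) λ e → (Cycle.steps C' ≡ P ++ [ (e , w) ]) × (w ∉ vsOf P)
    rotateTo C w∈ with ∈-map⁻ proj₂ w∈
    ... | ((e , .w) , s∈ , refl) with ∈-∃++ s∈
    ... | (A , B , eq) with rotate C (A ++ [ (e , w) ]) B (≡-trans eq (sym (List.++-assoc A [ (e , w) ] B)))
    ... | (C' , steps≡ , perm) =
      C' , perm , B ++ A , e , steps≡′ , λ m → Unique-++-disjoint (vsOf (B ++ A)) distinct m (here refl)
      where
      steps≡′ : Cycle.steps C' ≡ (B ++ A) ++ [ (e , w) ]
      steps≡′ = ≡-trans steps≡ (sym (List.++-assoc B A [ (e , w) ]))
      distinct : Unique (vsOf (B ++ A) ++ [ w ])
      distinct = subst Unique (≡-trans (cong vsOf steps≡′) (map-++ proj₂ (B ++ A) _)) (Cycle.distinctV C')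

    classify : (C : Cycle G) → All Old (cycleEdges C) → InSide C
    classify C old with any? (w ≟_) (vsOf (Cycle.steps C))
    ... | no w∉ = classifyAvoiding C old (avoid-all _ (All.map⁻ (∉⇒All≢ _ w∉)))
    ... | yes w∈ with rotateTo C w∈
    ... | (C' , perm , P , e , steps≡ , w∉P) =
      InSide-↭ {C} {C'} perm (classifyAvoiding C' (All-resp-↭ (↭-sym perm) old)
        (subst AvoidInner (sym steps≡) (avoid-snoc P (e , w) (All.map⁻ (∉⇒All≢ _ w∉P)))))

    classifyAll : (cs : List (Cycle G)) → All (λ D → All Old (cycleEdges D)) cs →
      Σ (List (Cycle H1)) λ cs1 → Σ (List (Cycle H2)) λ cs2 →
        (concatMap cycleEdges cs ↭ map (Embedding.fE h1) (concatMap cycleEdges cs1) ++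
                                   map (Embedding.fE h2) (concatMap cycleEdges cs2)) ×
        (length cs ≡ length cs1 + length cs2)
    classifyAll [] [] = [] , [] , ↭-refl , refl
    classifyAll (C ∷ cs) (o ∷ os) with classifyAll cs os | classify C o
    ... | (cs1 , cs2 , p , l) | inj₁ (C1 , q) =
      C1 ∷ cs1 , cs2 ,
      ↭-trans (++⁺ q p) (↭-reflexive (≡-trans (sym (List.++-assoc (map f1 (cycleEdges C1)) _ _))
                                              (cong (_++ _) (sym (map-++ f1 (cycleEdges C1) _))))) ,
      cong suc l
      where f1 = Embedding.fE h1
    ... | (cs1 , cs2 , p , l) | inj₂ (C2 , q) =
      cs1 , C2 ∷ cs2 ,
      ↭-trans (++⁺ q p) (↭-trans (shifts (map f2 (cycleEdges C2)) (map (Embedding.fE h1) (concatMap cycleEdges cs1)))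
                                 (↭-reflexive (cong (_ ++_) (sym (map-++ f2 (cycleEdges C2) _))))) ,
      ≡-trans (cong suc l) (sym (+-suc (length cs1) (length cs2)))
      where f2 = Embedding.fE h2

record Transfer (δ : ℕ) (G1 G2 G : Graph) : Set where
  field
    forward  : ∀ cs1 cs2 → IsDecomposition G1 cs1 → IsDecomposition G2 cs2 →
               Σ (List (Cycle G)) λ cs → IsDecomposition G cs × (length cs + δ ≡ length cs1 + length cs2)
    backward : ∀ cs → IsDecomposition G cs → Σ (List (Cycle G1)) λ cs1 → Σ (List (Cycle G2)) λ cs2 →
               IsDecomposition G1 cs1 × IsDecomposition G2 cs2 × (length cs + δ ≡ length cs1 + length cs2)

module _ {δ : ℕ} {G1 G2 G : Graph} (T : Transfer δ G1 G2 G) where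
  open Transfer T

  transfer-min : ∀ {c c₁ c₂} → IsMinCycleNumber G c → IsMinCycleNumber G1 c₁ → IsMinCycleNumber G2 c₂ →
                 c + δ ≡ c₁ + c₂
  transfer-min ((cs , dc , refl) , least) ((cs1 , dc1 , refl) , least1) ((cs2 , dc2 , refl) , least2)
    with forward cs1 cs2 dc1 dc2 | backward cs dc
  ... | (cs' , dc' , l) | (cs1' , cs2' , dc1' , dc2' , l') =
    ≤-antisym (≤-trans (+-monoˡ-≤ δ (least cs' dc')) (≤-reflexive l))
              (≤-trans (+-mono-≤ (least1 cs1' dc1') (least2 cs2' dc2')) (≤-reflexive (sym l')))

  transfer-max : ∀ {ν ν₁ ν₂} → IsMaxCycleNumber G ν → IsMaxCycleNumber G1 ν₁ → IsMaxCycleNumber G2 ν₂ →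
                 ν + δ ≡ ν₁ + ν₂
  transfer-max ((cs , dc , refl) , most) ((cs1 , dc1 , refl) , most1) ((cs2 , dc2 , refl) , most2)
    with forward cs1 cs2 dc1 dc2 | backward cs dc
  ... | (cs' , dc' , l) | (cs1' , cs2' , dc1' , dc2' , l') =
    ≤-antisym (≤-trans (≤-reflexive l') (+-mono-≤ (most1 cs1' dc1') (most2 cs2' dc2')))
              (≤-trans (≤-reflexive (sym l)) (+-monoˡ-≤ δ (most cs' dc')))

min≤max : ∀ {G c ν} → IsMinCycleNumber G c → IsMaxCycleNumber G ν → c ≤ ν
min≤max ((cs , dc , refl) , _) (_ , most) = most cs dc

∸-additive : ∀ δ {c ν c₁ ν₁ c₂ ν₂} → c + δ ≡ c₁ + c₂ → ν + δ ≡ ν₁ + ν₂ → c₁ ≤ ν₁ → c₂ ≤ ν₂ →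
             ν ∸ c ≡ (ν₁ ∸ c₁) + (ν₂ ∸ c₂)
∸-additive δ {c} {ν} {c₁} {ν₁} {c₂} {ν₂} cEq νEq c₁≤ν₁ c₂≤ν₂ = begin
  ν ∸ c                              ≡⟨ sym ([m+n]∸[m+o]≡n∸o δ ν c) ⟩
  (δ + ν) ∸ (δ + c)                  ≡⟨ cong₂ _∸_ (+-comm δ ν) (+-comm δ c) ⟩
  (ν + δ) ∸ (c + δ)                  ≡⟨ cong₂ _∸_ νEq cEq ⟩
  (ν₁ + ν₂) ∸ (c₁ + c₂)              ≡⟨ cong (_∸ (c₁ + c₂)) (sym (cong₂ _+_ (m+[n∸m]≡n c₁≤ν₁) (m+[n∸m]≡n c₂≤ν₂))) ⟩
  ((c₁ + a) + (c₂ + b)) ∸ (c₁ + c₂)  ≡⟨ cong (_∸ (c₁ + c₂)) (interchange c₁ a c₂ b) ⟩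
  ((c₁ + c₂) + (a + b)) ∸ (c₁ + c₂)  ≡⟨ m+n∸m≡n (c₁ + c₂) (a + b) ⟩
  a + b                              ∎
  where
  open ≡-Reasoning
  a = ν₁ ∸ c₁
  b = ν₂ ∸ c₂

defect-additive : ∀ {δ G1 G2 G} → Transfer δ G1 G2 G → DefectAdditive G1 G2 G
defect-additive {δ} T c ν c₁ ν₁ c₂ ν₂ min max min₁ max₁ min₂ max₂ =
  ∸-additive δ (transfer-min T min min₁ min₂) (transfer-max T max max₁ max₂) (min≤max min₁ max₁) (min≤max min₂ max₂)

isLeft : ∀ {A B : Set} → A ⊎ B → Bool
isLeft (inj₁ _) = true
isLeft (inj₂ _) = false

splitAt-left : ∀ m {n} (e : Fin (m + n)) → isLeft (splitAt m e) ≡ true → Σ (Fin m) λ a → a ↑ˡ n ≡ e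
splitAt-left m {n} e c with splitAt m e | join-splitAt m n e
... | inj₁ a | eq = a , eq

splitAt-right : ∀ m {n} (e : Fin (m + n)) → isLeft (splitAt m e) ≡ false → Σ (Fin n) λ b → m ↑ʳ b ≡ e
splitAt-right m {n} e c with splitAt m e | join-splitAt m n e
... | inj₂ b | eq = b , eq

module Merge {n1 k : ℕ} (w1 : Fin n1) (w2 : Fin (suc k)) where
  M : Fin (suc k) → Fin (n1 + k)
  M = mergeMap w1 w2

  M-w : M w2 ≡ w1 ↑ˡ k
  M-w with w2 ≟ w2
  ... | yes _ = refl
  ... | no w2≢w2 = ⊥-elim (w2≢w2 refl)

  M-left : ∀ {y x} → M y ≡ x ↑ˡ k → y ≡ w2
  M-left {y} {x} e with w2 ≟ y
  ... | yes p = sym p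
  ... | no _ = ⊥-elim (↑ˡ≢↑ʳ x _ (sym e))

  M-injective : ∀ {x y} → M x ≡ M y → x ≡ y
  M-injective {x} {y} e with w2 ≟ x | w2 ≟ y
  ... | yes p | yes q = ≡-trans (sym p) q
  ... | yes p | no q = ⊥-elim (↑ˡ≢↑ʳ w1 _ e)
  ... | no p | yes q = ⊥-elim (↑ˡ≢↑ʳ w1 _ (sym e))
  ... | no p | no q = punchOut-injective p q (↑ʳ-injective n1 _ _ e)

-- ⊙V.  The two sides of G share only the merged vertex, so every cycle of G lies in one
-- side; decompositions of G are exactly pairs of decompositions (δ = 0).

module VertexSum (n1 m1 : ℕ) (f1 : Fin m1 → Fin n1 × Fin n1)
                 (k m2 : ℕ) (f2 : Fin m2 → Fin (suc k) × Fin (suc k))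
                 (w1 : Fin n1) (w2 : Fin (suc k)) where
  G1 = graph n1 m1 f1
  G2 = graph (suc k) m2 f2
  G = opV G1 w1 G2 w2
  open Merge w1 w2

  h1 : Embedding G1 G
  h1 = record { fV = _↑ˡ k ; fE = _↑ˡ m2 ; comm = comm ; injV = ↑ˡ-injective k _ _ ; injE = ↑ˡ-injective m2 _ _ }
    where comm : ∀ e → ends G (e ↑ˡ m2) ≡ mapP (_↑ˡ k) (_↑ˡ k) (f1 e)
          comm e rewrite splitAt-↑ˡ m1 e m2 = refl

  h2 : Embedding G2 G
  h2 = record { fV = M ; fE = m1 ↑ʳ_ ; comm = comm ; injV = M-injective ; injE = ↑ʳ-injective m1 _ _ }
    where comm : ∀ e → ends G (m1 ↑ʳ e) ≡ mapP M M (f2 e)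
          comm e rewrite splitAt-↑ʳ m1 m2 e = refl

  col : Fin (m1 + m2) → Bool
  col e = isLeft (splitAt m1 e)

  open TwoSided G G1 G2 h1 h2 (λ _ → ⊤) col (λ e _ → splitAt-left m1 e) (λ e _ → splitAt-right m1 e)

  meet : SidesMeetIn (_≡ w1 ↑ˡ k)
  meet (a , refl) (b , refl) j j' with proj₂ (EmbeddingOps.incident h1 j) | proj₁ (EmbeddingOps.incident h2 j')
  ... | (x , refl) | (y , z≡My) = ≡-trans z≡My (≡-trans (cong M (M-left (sym z≡My))) M-w)

  open Classify (w1 ↑ˡ k) (colourChange meet)

  transfer : Transfer 0 G1 G2 G
  transfer = record { forward = forward ; backward = backward }
    where
    forward : ∀ cs1 cs2 → IsDecomposition G1 cs1 → IsDecomposition G2 cs2 →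
              Σ (List (Cycle G)) λ cs → IsDecomposition G cs × (length cs + 0 ≡ length cs1 + length cs2)
    forward cs1 cs2 dc1 dc2 =
      map (EmbeddingOps.mapCycle h1) cs1 ++ map (EmbeddingOps.mapCycle h2) cs2 ,
      subst (Enumerates (m1 + m2)) (sym (concat-pushTwo h1 h2 cs1 cs2)) (Enumerates-sum⁺ dc1 dc2) ,
      ≡-trans (+-identityʳ _) (length-pushTwo h1 h2 cs1 cs2)

    backward : ∀ cs → IsDecomposition G cs → Σ (List (Cycle G1)) λ cs1 → Σ (List (Cycle G2)) λ cs2 →
               IsDecomposition G1 cs1 × IsDecomposition G2 cs2 × (length cs + 0 ≡ length cs1 + length cs2)
    backward cs dc with classifyAll cs (All.tabulate (λ _ → All.tabulate (λ _ → tt)))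
    ... | (cs1 , cs2 , p , l) with Enumerates-sum⁻ (Enumerates-↭ p dc)
    ... | (dc1 , dc2) = cs1 , cs2 , dc1 , dc2 , ≡-trans (+-identityʳ _) l

theoremV : (G1 G2 : Graph) (w1 : Fin (nV G1)) (w2 : Fin (nV G2)) → DefectAdditive G1 G2 (opV G1 w1 G2 w2)
theoremV (graph n1 m1 f1) (graph zero m2 f2) w1 ()
theoremV (graph n1 m1 f1) (graph (suc k) m2 f2) w1 w2 = defect-additive (VertexSum.transfer n1 m1 f1 k m2 f2 w1 w2)

-- Both ⊙E and ⊙VE delete e1 from G1 and e2 from G2 and join the remaining
-- graphs H1 = G1 − e1 and H2 = G2 − e2 by n new edges (n = 2 for ⊙E, n = 1 for ⊙VE), so
-- that the edges of G are Fin ((k1 + k2) + n) with ki the number of edges of Hi.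
-- The transfer (with δ = 1) is reduced to two facts depending on the operation:
--  * a `Bridge`: paths u1 → v1 of H1 and v2 → u2 of H2 together with the new edges form
--    a cycle of G;
--  * a `Splitting`: a cycle of G through a new edge consists of the new edges and of
--    two paths, which close up to cycles through e1 of G1 and through e2 of G2;
-- together with the vertex w where edges of H1 and H2 may meet.

module Junction (G1 G2 : Graph) (e1 : Fin (nE G1)) (e2 : Fin (nE G2)) (s1 s2 : Bool)
  (n V : ℕ) (endsG : Fin ((pred (nE G1) + pred (nE G2)) + n) → Fin V × Fin V)
  (fV1 : Fin (nV G1) → Fin V) (fV2 : Fin (nV G2) → Fin V)
  (injV1 : ∀ {x y} → fV1 x ≡ fV1 y → x ≡ y) (injV2 : ∀ {x y} → fV2 x ≡ fV2 y → x ≡ y)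
  (comm1 : ∀ i → endsG ((i ↑ˡ pred (nE G2)) ↑ˡ n) ≡ mapP fV1 fV1 (ends G1 (delEdge e1 i)))
  (comm2 : ∀ i → endsG ((pred (nE G1) ↑ʳ i) ↑ˡ n) ≡ mapP fV2 fV2 (ends G2 (delEdge e2 i))) where

  H1 = delG G1 e1
  H2 = delG G2 e2
  k1 = pred (nE G1)
  k2 = pred (nE G2)
  K = k1 + k2

  G : Graph
  G = graph V (K + n) endsG

  u1 = endU G1 e1 s1
  v1 = endV G1 e1 s1
  u2 = endU G2 e2 s2
  v2 = endV G2 e2 s2

  ι1 : Fin k1 → Fin (K + n)
  ι1 i = (i ↑ˡ k2) ↑ˡ n

  ι2 : Fin k2 → Fin (K + n)
  ι2 i = (k1 ↑ʳ i) ↑ˡ n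

  new : Fin n → Fin (K + n)
  new j = K ↑ʳ j

  g1 : Embedding H1 G
  g1 = record { fV = fV1 ; fE = ι1 ; comm = comm1 ; injV = injV1
              ; injE = λ e → ↑ˡ-injective k2 _ _ (↑ˡ-injective n _ _ e) }

  g2 : Embedding H2 G
  g2 = record { fV = fV2 ; fE = ι2 ; comm = comm2 ; injV = injV2
              ; injE = λ e → ↑ʳ-injective k1 _ _ (↑ˡ-injective n _ _ e) }

  module Emb1 = EmbeddingOps g1
  module Emb2 = EmbeddingOps g2

  layout : List (Fin k1) → List (Fin k2) → List (Fin (K + n))
  layout X1 X2 = (map ι1 X1 ++ map ι2 X2) ++ map new (allFin n)

  layout-≡ : ∀ X1 X2 →
    map (_↑ˡ n) (map (_↑ˡ k2) X1 ++ map (k1 ↑ʳ_) X2) ++ map (K ↑ʳ_) (allFin n) ≡ layout X1 X2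
  layout-≡ X1 X2 = cong (_++ map new (allFin n))
    (≡-trans (map-++ (_↑ˡ n) (map (_↑ˡ k2) X1) (map (k1 ↑ʳ_) X2))
             (sym (cong₂ _++_ (map-∘ {g = _↑ˡ n} {f = _↑ˡ k2} X1) (map-∘ {g = _↑ˡ n} {f = k1 ↑ʳ_} X2))))

  layout-unique : ∀ {X1 X2} → Unique X1 → Unique X2 → Unique (layout X1 X2)
  layout-unique {X1} {X2} u1 u2 =
    subst Unique (layout-≡ X1 X2) (Unique-sum⁺ (Unique-sum⁺ u1 u2) (proj₁ (allFin-enumerates n)))

  layout⁺ : ∀ {X1 X2} → Enumerates k1 X1 → Enumerates k2 X2 → Enumerates (K + n) (layout X1 X2)
  layout⁺ {X1} {X2} en1 en2 =
    subst (Enumerates (K + n)) (layout-≡ X1 X2) (Enumerates-sum⁺ (Enumerates-sum⁺ en1 en2) (allFin-enumerates n))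

  layout⁻ : ∀ {X1 X2} → Enumerates (K + n) (layout X1 X2) → Enumerates k1 X1 × Enumerates k2 X2
  layout⁻ {X1} {X2} en =
    Enumerates-sum⁻ (proj₁ (Enumerates-sum⁻ {xs = map (_↑ˡ k2) X1 ++ map (k1 ↑ʳ_) X2} {ys = allFin n}
                                            (subst (Enumerates (K + n)) (sym (layout-≡ X1 X2)) en)))

  layout-merge : ∀ Y1 Y2 E1 E2 → layout Y1 Y2 ++ (map ι1 E1 ++ map ι2 E2) ↭ layout (Y1 ++ E1) (Y2 ++ E2)
  layout-merge Y1 Y2 E1 E2 rewrite map-++ ι1 Y1 E1 | map-++ ι2 Y2 E2 =
    solve 5 (λ a1 a2 b1 b2 ν → ((a1 ⊕ a2) ⊕ ν) ⊕ (b1 ⊕ b2) ⊜ ((a1 ⊕ b1) ⊕ (a2 ⊕ b2)) ⊕ ν) ↭-refl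
      (map ι1 Y1) (map ι2 Y2) (map ι1 E1) (map ι2 E2) (map new (allFin n))
    where open ++-Solver {Fin (K + n)}

  Old : Fin (K + n) → Set
  Old e = ∀ j → e ≢ new j

  col : Fin (K + n) → Bool
  col e = [ (λ i → isLeft (splitAt k1 i)) , (λ _ → true) ]′ (splitAt K e)

  colT : ∀ e → Old e → col e ≡ true → InIm g1 e
  colT e old c with splitAt K e | join-splitAt K n e
  ... | inj₂ j | eq = ⊥-elim (old j (sym eq))
  ... | inj₁ i | eq with splitAt-left k1 i c
  ...   | (a , a≡i) = a , ≡-trans (cong (_↑ˡ n) a≡i) eq

  colF : ∀ e → Old e → col e ≡ false → InIm g2 e
  colF e old c with splitAt K e | join-splitAt K n e
  ... | inj₂ j | eq = ⊥-elim (old j (sym eq))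
  ... | inj₁ i | eq with splitAt-right k1 i c
  ...   | (b , b≡i) = b , ≡-trans (cong (_↑ˡ n) b≡i) eq

  open TwoSided G H1 H2 g1 g2 Old col colT colF public

  Bridge : Set
  Bridge = ∀ W1 W2 → WalkFromTo H1 u1 W1 v1 → Unique (u1 ∷ vsOf W1) → Unique (esOf W1) →
                     WalkFromTo H2 v2 W2 u2 → Unique (v2 ∷ vsOf W2) → Unique (esOf W2) →
                     Σ (Cycle G) λ Γ → cycleEdges Γ ↭ layout (esOf W1) (esOf W2)

  record Halves (C : Cycle G) : Set where
    constructor halves
    field
      D1 : Cycle G1
      D2 : Cycle G2
      Y1 : List (Fin k1)
      Y2 : List (Fin k2)
      edges1 : cycleEdges D1 ≡ map (delEdge e1) Y1 ++ [ e1 ]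
      edges2 : cycleEdges D2 ≡ map (delEdge e2) Y2 ++ [ e2 ]
      edges  : cycleEdges C ↭ layout Y1 Y2

  Splitting : Fin n → Set
  Splitting j = ∀ (C : Cycle G) → new j ∈ cycleEdges C → Halves C

  disjoint-old : ∀ {C : Cycle G} {Y1 Y2} (others : List (Cycle G)) → cycleEdges C ↭ layout Y1 Y2 →
                 Unique (cycleEdges C ++ concatMap cycleEdges others) → All (λ D → All Old (cycleEdges D)) others
  disjoint-old {C} {Y1} {Y2} others edgesC u = All.tabulate λ {D} D∈ → All.tabulate λ {x} x∈ j x≡ →
    Unique-++-disjoint (cycleEdges C) u (newInC j) (∈-concatMap⁺ cycleEdges D∈ (subst (_∈ cycleEdges D) x≡ x∈))
    where
    newInC : ∀ j → new j ∈ cycleEdges C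
    newInC j = ∈-resp-↭ (↭-sym edgesC) (∈-++⁺ʳ (map ι1 Y1 ++ map ι2 Y2) (∈-map⁺ new (∈-allFin j)))

  -- one cycle of G replaces the two cycles through e1 and e2
  length-shift : ∀ a b → suc (a + b) + 1 ≡ suc a + suc b
  length-shift a b = ≡-trans (+-comm (suc (a + b)) 1) (cong suc (sym (+-suc a b)))

  forward : Bridge → ∀ cs1 cs2 → IsDecomposition G1 cs1 → IsDecomposition G2 cs2 →
            Σ (List (Cycle G)) λ cs → IsDecomposition G cs × (length cs + 1 ≡ length cs1 + length cs2)
  forward bridge cs1 cs2 dc1 dc2 =
    Γ ∷ (map Emb1.mapCycle O1.rest ++ map Emb2.mapCycle O2.rest) ,
    Enumerates-↭ (↭-sym reorder) (layout⁺ O1.enum O2.enum) ,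
    (begin
      suc (length (map Emb1.mapCycle O1.rest ++ map Emb2.mapCycle O2.rest)) + 1
        ≡⟨ cong (λ l → suc l + 1) (length-pushTwo g1 g2 O1.rest O2.rest) ⟩
      suc (length O1.rest + length O2.rest) + 1
        ≡⟨ length-shift (length O1.rest) (length O2.rest) ⟩
      suc (length O1.rest) + suc (length O2.rest)
        ≡⟨ sym (cong₂ _+_ O1.size O2.size) ⟩
      length cs1 + length cs2 ∎)
    where
    open ≡-Reasoning
    module O1 = OpenDecomposition (openDecomposition G1 e1 s1 cs1 dc1)
    module O2 = OpenDecomposition (openDecomposition G2 e2 (not s2) cs2 dc2)
    bridged : Σ (Cycle G) λ Γ → cycleEdges Γ ↭ layout (esOf O1.path) (esOf O2.path)
    bridged = bridge O1.path O2.path O1.walk O1.distinctV (Unique-++ˡ (esOf O1.path) (proj₁ O1.enum))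
      (subst₂ (λ a b → WalkFromTo H2 a O2.path b) (endU-not G2 e2 s2) (endV-not G2 e2 s2) O2.walk)
      (subst (λ a → Unique (a ∷ vsOf O2.path)) (endU-not G2 e2 s2) O2.distinctV)
      (Unique-++ˡ (esOf O2.path) (proj₁ O2.enum))
    Γ : Cycle G
    Γ = proj₁ bridged
    reorder : cycleEdges Γ ++ concatMap cycleEdges (map Emb1.mapCycle O1.rest ++ map Emb2.mapCycle O2.rest) ↭
              layout (esOf O1.path ++ concatMap cycleEdges O1.rest) (esOf O2.path ++ concatMap cycleEdges O2.rest)
    reorder = ↭-trans (++⁺ (proj₂ bridged) (↭-reflexive (concat-pushTwo g1 g2 O1.rest O2.rest)))
                      (layout-merge (esOf O1.path) (esOf O2.path) (concatMap cycleEdges O1.rest) (concatMap cycleEdges O2.rest))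

  backward : (j : Fin n) → Splitting j → (w : Fin V) → SidesMeetIn (_≡ w) →
             ∀ cs → IsDecomposition G cs → Σ (List (Cycle G1)) λ cs1 → Σ (List (Cycle G2)) λ cs2 →
             IsDecomposition G1 cs1 × IsDecomposition G2 cs2 × (length cs + 1 ≡ length cs1 + length cs2)
  backward j splitting w meet cs dc =
    D1 ∷ map (EmbeddingOps.mapCycle (delEmbedding G1 e1)) R1 ,
    D2 ∷ map (EmbeddingOps.mapCycle (delEmbedding G2 e2)) R2 ,
    closeDecomposition G1 e1 D1 Y1 edges1 R1 (proj₁ enums) ,
    closeDecomposition G2 e2 D2 Y2 edges2 R2 (proj₂ enums) ,
    (begin
      length cs + 1                       ≡⟨ cong (_+ 1) (≡-trans (↭-length perm) (cong suc lenR)) ⟩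
      suc (length R1 + length R2) + 1     ≡⟨ length-shift (length R1) (length R2) ⟩
      suc (length R1) + suc (length R2)   ≡⟨ sym (cong₂ (λ a b → suc a + suc b) (length-map _ R1) (length-map _ R2)) ⟩
      suc (length (map (EmbeddingOps.mapCycle (delEmbedding G1 e1)) R1)) +
        suc (length (map (EmbeddingOps.mapCycle (delEmbedding G2 e2)) R2)) ∎)
    where
    open Classify w (colourChange meet)
    open ≡-Reasoning
    open Detached (detach cs dc (new j))
    open Halves (splitting cyc through)
    classified = classifyAll others (disjoint-old {cyc} {Y1} {Y2} others edges (proj₁ enum))
    R1 = proj₁ classified
    R2 = proj₁ (proj₂ classified)
    lenR : length others ≡ length R1 + length R2
    lenR = proj₂ (proj₂ (proj₂ classified))
    enums : Enumerates k1 (Y1 ++ concatMap cycleEdges R1) × Enumerates k2 (Y2 ++ concatMap cycleEdges R2)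
    enums = layout⁻ (Enumerates-↭ (↭-trans (++⁺ edges (proj₁ (proj₂ (proj₂ classified))))
                                            (layout-merge Y1 Y2 _ _)) enum)

  transfer : Bridge → (j : Fin n) → Splitting j → (w : Fin V) → SidesMeetIn (_≡ w) → Transfer 1 G1 G2 G
  transfer bridge j splitting w meet =
    record { forward = forward bridge ; backward = backward j splitting w meet }

-- G consists of H1 = G1 − e1 on the vertices L(V(G1)), H2 = G2 − e2 on the disjoint
-- vertices R(V(G2)), and the new edges N0 = u1u2 and N1 = v1v2.  Old edges of the two
-- sides never meet, so a cycle through N0 must also use N1, and falls into a path of H1
-- between u1 and v1 and a path of H2 between v2 and u2.

module EdgeSum (G1 G2 : Graph) (ll1 : Loopless G1) (ll2 : Loopless G2)
               (e1 : Fin (nE G1)) (s1 : Bool) (e2 : Fin (nE G2)) (s2 : Bool) where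
  private
    n1 = nV G1
    n2 = nV G2
    k1 = pred (nE G1)
    k2 = pred (nE G2)

  L : Fin n1 → Fin (n1 + n2)
  L x = x ↑ˡ n2

  R : Fin n2 → Fin (n1 + n2)
  R y = n1 ↑ʳ y

  L≢R : ∀ {a b} → L a ≢ R b
  L≢R = ↑ˡ≢↑ʳ _ _

  comm1 : ∀ i → ends (opE G1 e1 s1 G2 e2 s2) ((i ↑ˡ k2) ↑ˡ 2) ≡ mapP L L (ends G1 (delEdge e1 i))
  comm1 i rewrite splitAt-↑ˡ (k1 + k2) (i ↑ˡ k2) 2 | splitAt-↑ˡ k1 i k2 = refl

  comm2 : ∀ i → ends (opE G1 e1 s1 G2 e2 s2) ((k1 ↑ʳ i) ↑ˡ 2) ≡ mapP R R (ends G2 (delEdge e2 i))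
  comm2 i rewrite splitAt-↑ˡ (k1 + k2) (k1 ↑ʳ i) 2 | splitAt-↑ʳ k1 k2 i = refl

  open Junction G1 G2 e1 e2 s1 s2 2 (n1 + n2) (ends (opE G1 e1 s1 G2 e2 s2)) L R
                (↑ˡ-injective n2 _ _) (↑ʳ-injective n1 _ _) comm1 comm2

  N0 N1 : Fin (K + 2)
  N0 = new zero
  N1 = new (suc zero)

  endsN0 : ends G N0 ≡ (L u1 , R u2)
  endsN0 rewrite splitAt-↑ʳ K 2 zero = refl

  endsN1 : ends G N1 ≡ (L v1 , R v2)
  endsN1 rewrite splitAt-↑ʳ K 2 (suc zero) = refl

  u1≢v1 : u1 ≢ v1
  u1≢v1 = endUV-≢ G1 ll1 e1 s1

  u2≢v2 : u2 ≢ v2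
  u2≢v2 = endUV-≢ G2 ll2 e2 s2

  bridge : Bridge
  bridge W1 W2 w1 dv1 de1 w2 dv2 de2 = cycle (L u1) S walkS lengthS distinctV distinctE , edgesS
    where
    S : List (Step G)
    S = Emb1.mapSt W1 ++ (N1 , R v2) ∷ (Emb2.mapSt W2 ++ [ (N0 , L u1) ])
    walkS : WalkFromTo G (L u1) S (L u1)
    walkS = walk-++ (Emb1.mapSt W1) (Emb1.walk-map W1 w1)
              (inj₁ endsN1 , walk-++ (Emb2.mapSt W2) (Emb2.walk-map W2 w2) (inj₂ endsN0 , refl))
    lengthS : 2 ≤ length S
    lengthS = ≤-trans (s≤s (snoc-length (Emb2.mapSt W2) _)) (List.length-++-≤ʳ ((N1 , R v2) ∷ _) {Emb1.mapSt W1})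
    vertices : vsOf S ≡ map L (vsOf W1) ++ R v2 ∷ (map R (vsOf W2) ++ [ L u1 ])
    vertices = ≡-trans (map-++ proj₂ (Emb1.mapSt W1) _) (cong₂ _++_ (Emb1.vs-map W1) (cong (R v2 ∷_)
      (≡-trans (map-++ proj₂ (Emb2.mapSt W2) _) (cong (_++ [ L u1 ]) (Emb2.vs-map W2)))))
    edges : esOf S ≡ map ι1 (esOf W1) ++ N1 ∷ (map ι2 (esOf W2) ++ [ N0 ])
    edges = ≡-trans (map-++ proj₁ (Emb1.mapSt W1) _) (cong₂ _++_ (Emb1.es-map W1) (cong (N1 ∷_)
      (≡-trans (map-++ proj₁ (Emb2.mapSt W2) _) (cong (_++ [ N0 ]) (Emb2.es-map W2)))))
    edgesS : esOf S ↭ layout (esOf W1) (esOf W2)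
    edgesS = subst (_↭ layout (esOf W1) (esOf W2)) (sym edges)
      (solve 4 (λ a y b x → a ⊕ (y ⊕ (b ⊕ x)) ⊜ (a ⊕ b) ⊕ (x ⊕ y)) ↭-refl
               (map ι1 (esOf W1)) [ N1 ] (map ι2 (esOf W2)) [ N0 ])
      where open ++-Solver {Fin (K + 2)}
    distinctV : Unique (vsOf S)
    distinctV = subst Unique (sym vertices) (Unique-↭
      (solve 4 (λ x a y b → (x ⊕ a) ⊕ (y ⊕ b) ⊜ a ⊕ (y ⊕ (b ⊕ x))) ↭-refl
               [ L u1 ] (map L (vsOf W1)) [ R v2 ] (map R (vsOf W2)))
      (Unique-sum⁺ dv1 dv2))
      where open ++-Solver {Fin (n1 + n2)}
    distinctE : Unique (esOf S)
    distinctE = Unique-↭ (↭-sym edgesS) (layout-unique de1 de2)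

  sides-apart : SidesMeetIn (λ _ → ⊥)
  sides-apart (a , refl) (b , refl) j j' with proj₂ (Emb1.incident j) | proj₁ (Emb2.incident j')
  ... | (x , refl) | (y , eq) = L≢R eq

  open Avoiding (λ _ → ⊥) (colourChange sides-apart)

  stayLeft : ∀ {a t} P → WalkFromTo G (L a) P t → All (Old ∘ proj₁) P →
             Σ _ λ b → (t ≡ L b) × Σ (List (Step H1)) λ W → (P ≡ Emb1.mapSt W) × WalkFromTo H1 a W b
  stayLeft {a} [] refl _ = a , refl , [] , refl , refl
  stayLeft (s ∷ P) w old with walk-side (s ∷ P) (λ ()) w old (avoid-all _ (All.tabulate λ _ ()))
  ... | inj₂ (_ , _ , _ , La≡Rb , _) = ⊥-elim (L≢R La≡Rb)
  ... | inj₁ (_ , b , W , La≡La' , t≡Lb , P≡ , wW) with ↑ˡ-injective n2 _ _ La≡La'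
  ...   | refl = b , t≡Lb , W , P≡ , wW

  stayRight : ∀ {a t} P → WalkFromTo G (R a) P t → All (Old ∘ proj₁) P →
              Σ _ λ b → (t ≡ R b) × Σ (List (Step H2)) λ W → (P ≡ Emb2.mapSt W) × WalkFromTo H2 a W b
  stayRight {a} [] refl _ = a , refl , [] , refl , refl
  stayRight (s ∷ P) w old with walk-side (s ∷ P) (λ ()) w old (avoid-all _ (All.tabulate λ _ ()))
  ... | inj₁ (_ , _ , _ , Ra≡Lb , _) = ⊥-elim (L≢R (sym Ra≡Lb))
  ... | inj₂ (_ , b , W , Ra≡Ra' , t≡Rb , P≡ , wW) with ↑ʳ-injective n1 _ _ Ra≡Ra'
  ...   | refl = b , t≡Rb , W , P≡ , wW

  oldSteps : ∀ (X : List (Step G)) → N0 ∉ esOf X → N1 ∉ esOf X → All (Old ∘ proj₁) X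
  oldSteps X n0 n1 = All.map⁻ (All.zipWith (λ (a , b) → λ { zero → a ; (suc zero) → b })
                                            (∉⇒All≢ (esOf X) n0 , ∉⇒All≢ (esOf X) n1))

  -- the new edges are the only connections between the sides
  no-crossing : ∀ {z t} P → WalkFromTo G z P t → Joins G N0 t z → All (Old ∘ proj₁) P → ⊥
  no-crossing P wP jN0 old with joins-ends {G} endsN0 jN0
  ... | inj₁ (refl , refl) = L≢R (proj₁ (proj₂ (stayRight P wP old)))
  ... | inj₂ (refl , refl) = L≢R (sym (proj₁ (proj₂ (stayLeft P wP old))))

  halvesLR : ∀ {C : Cycle G} WA WB → WalkFromTo H1 u1 WA v1 → WalkFromTo H2 v2 WB u2 →
    Unique (vsOf (Emb1.mapSt WA ++ (N1 , R v2) ∷ Emb2.mapSt WB) ++ [ L u1 ]) →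
    Unique (esOf (Emb1.mapSt WA ++ (N1 , R v2) ∷ Emb2.mapSt WB) ++ [ N0 ]) →
    esOf (Emb1.mapSt WA ++ (N1 , R v2) ∷ Emb2.mapSt WB) ++ [ N0 ] ↭ cycleEdges C → Halves C
  halvesLR WA WB wA wB dv de edgesC =
    halves (proj₁ D1) (proj₁ D2) (esOf WA) (esOf WB) (proj₂ D1) (proj₂ D2) (↭-trans (↭-sym edgesC) reorder)
    where
    es≡ : esOf (Emb1.mapSt WA ++ (N1 , R v2) ∷ Emb2.mapSt WB) ≡ map ι1 (esOf WA) ++ N1 ∷ map ι2 (esOf WB)
    es≡ = ≡-trans (map-++ proj₁ (Emb1.mapSt WA) _) (cong₂ _++_ (Emb1.es-map WA) (cong (N1 ∷_) (Emb2.es-map WB)))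
    vs≡ : vsOf (Emb1.mapSt WA ++ (N1 , R v2) ∷ Emb2.mapSt WB) ≡ map L (vsOf WA) ++ R v2 ∷ map R (vsOf WB)
    vs≡ = ≡-trans (map-++ proj₂ (Emb1.mapSt WA) _) (cong₂ _++_ (Emb1.vs-map WA) (cong (R v2 ∷_) (Emb2.vs-map WB)))
    dvs = Unique-halves L R (vsOf WA) u1 (vsOf WB) v2 (subst (λ l → Unique (l ++ [ L u1 ])) vs≡ dv)
    des = Unique-around (map ι1 (esOf WA)) N1 (map ι2 (esOf WB)) N0 (subst (λ l → Unique (l ++ [ N0 ])) es≡ de)
    D1 = pathToCycle G1 e1 WA wA (Joins-sym {G1} (endUV G1 e1 s1)) u1≢v1 (proj₁ dvs) (Unique.map⁻ (proj₁ des))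
    D2 = pathToCycle G2 e2 WB wB (endUV G2 e2 s2) (u2≢v2 ∘ sym) (proj₂ dvs) (Unique.map⁻ (proj₂ des))
    reorder : esOf (Emb1.mapSt WA ++ (N1 , R v2) ∷ Emb2.mapSt WB) ++ [ N0 ] ↭ layout (esOf WA) (esOf WB)
    reorder rewrite es≡ =
      solve 4 (λ a y b x → (a ⊕ (y ⊕ b)) ⊕ x ⊜ (a ⊕ b) ⊕ (x ⊕ y)) ↭-refl
        (map ι1 (esOf WA)) [ N1 ] (map ι2 (esOf WB)) [ N0 ]
      where open ++-Solver {Fin (K + 2)}

  halvesRL : ∀ {C : Cycle G} WB WA → WalkFromTo H2 u2 WB v2 → WalkFromTo H1 v1 WA u1 →
    Unique (vsOf (Emb2.mapSt WB ++ (N1 , L v1) ∷ Emb1.mapSt WA) ++ [ R u2 ]) →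
    Unique (esOf (Emb2.mapSt WB ++ (N1 , L v1) ∷ Emb1.mapSt WA) ++ [ N0 ]) →
    esOf (Emb2.mapSt WB ++ (N1 , L v1) ∷ Emb1.mapSt WA) ++ [ N0 ] ↭ cycleEdges C → Halves C
  halvesRL WB WA wB wA dv de edgesC =
    halves (proj₁ D1) (proj₁ D2) (esOf WA) (esOf WB) (proj₂ D1) (proj₂ D2) (↭-trans (↭-sym edgesC) reorder)
    where
    es≡ : esOf (Emb2.mapSt WB ++ (N1 , L v1) ∷ Emb1.mapSt WA) ≡ map ι2 (esOf WB) ++ N1 ∷ map ι1 (esOf WA)
    es≡ = ≡-trans (map-++ proj₁ (Emb2.mapSt WB) _) (cong₂ _++_ (Emb2.es-map WB) (cong (N1 ∷_) (Emb1.es-map WA)))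
    vs≡ : vsOf (Emb2.mapSt WB ++ (N1 , L v1) ∷ Emb1.mapSt WA) ≡ map R (vsOf WB) ++ L v1 ∷ map L (vsOf WA)
    vs≡ = ≡-trans (map-++ proj₂ (Emb2.mapSt WB) _) (cong₂ _++_ (Emb2.vs-map WB) (cong (L v1 ∷_) (Emb1.vs-map WA)))
    dvs = Unique-halves R L (vsOf WB) u2 (vsOf WA) v1 (subst (λ l → Unique (l ++ [ R u2 ])) vs≡ dv)
    des = Unique-around (map ι2 (esOf WB)) N1 (map ι1 (esOf WA)) N0 (subst (λ l → Unique (l ++ [ N0 ])) es≡ de)
    D1 = pathToCycle G1 e1 WA wA (endUV G1 e1 s1) (u1≢v1 ∘ sym) (proj₂ dvs) (Unique.map⁻ (proj₂ des))
    D2 = pathToCycle G2 e2 WB wB (Joins-sym {G2} (endUV G2 e2 s2)) u2≢v2 (proj₁ dvs) (Unique.map⁻ (proj₁ des))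
    reorder : esOf (Emb2.mapSt WB ++ (N1 , L v1) ∷ Emb1.mapSt WA) ++ [ N0 ] ↭ layout (esOf WA) (esOf WB)
    reorder rewrite es≡ =
      solve 4 (λ b y a x → (b ⊕ (y ⊕ a)) ⊕ x ⊜ (a ⊕ b) ⊕ (x ⊕ y)) ↭-refl
        (map ι2 (esOf WB)) [ N1 ] (map ι1 (esOf WA)) [ N0 ]
      where open ++-Solver {Fin (K + 2)}

  -- a cycle through N0, cut open at N0: it crosses back through N1
  halvesAt : ∀ {C : Cycle G} {z t} P → WalkFromTo G z P t → Joins G N0 t z →
             Unique (vsOf P ++ [ z ]) → Unique (esOf P ++ [ N0 ]) → esOf P ++ [ N0 ] ↭ cycleEdges C → Halves C
  halvesAt P wP jN0 dv de edgesC with any? (N1 ≟_) (esOf P)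
  ... | no N1∉ = ⊥-elim (no-crossing P wP jN0 (oldSteps P (λ m → Unique-++-disjoint (esOf P) de m (here refl)) N1∉))
  ... | yes N1∈ with ∈-map⁻ proj₁ N1∈
  ... | ((.N1 , q) , q∈ , refl) with ∈-∃++ q∈
  ... | (A , B , refl) with walk-split A wP
  ... | (p , wA , (jN1 , wB)) = orient (joins-ends {G} endsN0 jN0) (joins-ends {G} endsN1 jN1)
    where
    es≡ : esOf (A ++ (N1 , q) ∷ B) ≡ esOf A ++ N1 ∷ esOf B
    es≡ = map-++ proj₁ A _
    de' : Unique ((esOf A ++ N1 ∷ esOf B) ++ [ N0 ])
    de' = subst (λ l → Unique (l ++ [ N0 ])) es≡ de
    N0∉ : N0 ∉ esOf A ++ N1 ∷ esOf B
    N0∉ m = Unique-++-disjoint (esOf A ++ N1 ∷ esOf B) de' m (here refl)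
    oldA : All (Old ∘ proj₁) A
    oldA = oldSteps A (N0∉ ∘ ∈-++⁺ˡ) (λ m → Unique-++-disjoint (esOf A) (Unique-++ˡ _ de') m (here refl))
    oldB : All (Old ∘ proj₁) B
    oldB = oldSteps B (N0∉ ∘ ∈-++⁺ʳ (esOf A) ∘ there)
                      (Unique.Unique[x∷xs]⇒x∉xs (Unique-++ʳ (esOf A) (Unique-++ˡ _ de')))
    orient : _ → _ → Halves _
    orient (inj₂ (refl , refl)) (inj₁ (refl , refl)) with stayLeft A wA oldA | stayRight B wB oldB
    ... | (b , Lv1≡Lb , WA , refl , wWA) | (b' , Ru2≡Rb' , WB , refl , wWB)
        with ↑ˡ-injective n2 _ _ Lv1≡Lb | ↑ʳ-injective n1 _ _ Ru2≡Rb'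
    ...   | refl | refl = halvesLR WA WB wWA wWB dv de edgesC
    orient (inj₁ (refl , refl)) (inj₂ (refl , refl)) with stayRight A wA oldA | stayLeft B wB oldB
    ... | (b , Rv2≡Rb , WB , refl , wWB) | (b' , Lu1≡Lb' , WA , refl , wWA)
        with ↑ʳ-injective n1 _ _ Rv2≡Rb | ↑ˡ-injective n2 _ _ Lu1≡Lb'
    ...   | refl | refl = halvesRL WB WA wWB wWA dv de edgesC
    orient (inj₂ (refl , refl)) (inj₂ (refl , refl)) = ⊥-elim (L≢R (sym (proj₁ (proj₂ (stayLeft A wA oldA)))))
    orient (inj₁ (refl , refl)) (inj₁ (refl , refl)) = ⊥-elim (L≢R (proj₁ (proj₂ (stayRight A wA oldA))))

  splitting : Splitting zero
  splitting C N0∈ with cutAt C N0∈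
  ... | cut z t P wP jN0 dv de edgesC = halvesAt P wP jN0 dv de edgesC

  result : DefectAdditive G1 G2 (opE G1 e1 s1 G2 e2 s2)
  result = defect-additive (transfer bridge zero splitting (L u1) (λ i i' j j' → ⊥-elim (sides-apart i i' j j')))

-- G consists of H1 = G1 − e1 on L(V(G1)), H2 = G2 − e2 on M(V(G2)), the two sharing
-- only the vertex v = L v1 = M v2, and the new edge N = u1u2.  Old edges of the two
-- sides meet only at v, so a cycle through N passes through v, and v splits it into a
-- path of H1 between u1 and v1 and a path of H2 between v2 and u2.

module VertexEdgeSum (G1 : Graph) (m2 k2 : ℕ) (f2 : Fin k2 → Fin (suc m2) × Fin (suc m2))
                     (ll1 : Loopless G1) (ll2 : Loopless (graph (suc m2) k2 f2))
                     (e1 : Fin (nE G1)) (s1 : Bool) (e2 : Fin k2) (s2 : Bool) where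
  G2 = graph (suc m2) k2 f2

  private
    n1 = nV G1
    k1 = pred (nE G1)
    k2' = pred k2

  open Merge (endV G1 e1 s1) (endV G2 e2 s2)

  L : Fin n1 → Fin (n1 + m2)
  L x = x ↑ˡ m2

  L-injective : ∀ {a b} → L a ≡ L b → a ≡ b
  L-injective = ↑ˡ-injective m2 _ _

  comm1 : ∀ i → ends (opVE G1 e1 s1 G2 e2 s2) ((i ↑ˡ k2') ↑ˡ 1) ≡ mapP L L (ends G1 (delEdge e1 i))
  comm1 i rewrite splitAt-↑ˡ (k1 + k2') (i ↑ˡ k2') 1 | splitAt-↑ˡ k1 i k2' = refl

  comm2 : ∀ i → ends (opVE G1 e1 s1 G2 e2 s2) ((k1 ↑ʳ i) ↑ˡ 1) ≡ mapP M M (ends G2 (delEdge e2 i))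
  comm2 i rewrite splitAt-↑ˡ (k1 + k2') (k1 ↑ʳ i) 1 | splitAt-↑ʳ k1 k2' i = refl

  open Junction G1 G2 e1 e2 s1 s2 1 (n1 + m2) (ends (opVE G1 e1 s1 G2 e2 s2)) L M
                L-injective M-injective comm1 comm2

  N : Fin (K + 1)
  N = new zero

  endsN : ends G N ≡ (L u1 , M u2)
  endsN rewrite splitAt-↑ʳ K 1 zero = refl

  v : Fin (n1 + m2)
  v = L v1

  u1≢v1 : u1 ≢ v1
  u1≢v1 = endUV-≢ G1 ll1 e1 s1

  u2≢v2 : u2 ≢ v2
  u2≢v2 = endUV-≢ G2 ll2 e2 s2

  Mu2≢L : ∀ {a} → M u2 ≢ L a
  Mu2≢L e = u2≢v2 (M-left e)

  Lu1≢M : ∀ {b} → L u1 ≢ M b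
  Lu1≢M {b} e with M-left (sym e)
  ... | refl = u1≢v1 (L-injective (≡-trans e M-w))

  bridge : Bridge
  bridge [] W2 w1 _ _ _ _ _ = ⊥-elim (u1≢v1 w1)
  bridge (st ∷ W1) W2 w1 dv1 de1 w2 (v2∉ ∷ dvW2) de2 = cycle (L u1) S walkS lengthS distinctV distinctE , edgesS
    where
    S : List (Step G)
    S = Emb1.mapSt (st ∷ W1) ++ (Emb2.mapSt W2 ++ [ (N , L u1) ])
    walkS : WalkFromTo G (L u1) S (L u1)
    walkS = walk-++ (Emb1.mapSt (st ∷ W1)) (Emb1.walk-map (st ∷ W1) w1)
              (walk-++ (Emb2.mapSt W2) (subst (λ a → WalkFromTo G a (Emb2.mapSt W2) (M u2)) M-w (Emb2.walk-map W2 w2))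
                       (inj₂ endsN , refl))
    lengthS : 2 ≤ length S
    lengthS = s≤s (≤-trans (snoc-length (Emb2.mapSt W2) _) (List.length-++-≤ʳ (Emb2.mapSt W2 ++ _) {Emb1.mapSt W1}))
    vertices : vsOf S ≡ map L (vsOf (st ∷ W1)) ++ (map M (vsOf W2) ++ [ L u1 ])
    vertices = ≡-trans (map-++ proj₂ (Emb1.mapSt (st ∷ W1)) _)
      (cong₂ _++_ (Emb1.vs-map (st ∷ W1)) (≡-trans (map-++ proj₂ (Emb2.mapSt W2) _) (cong (_++ [ L u1 ]) (Emb2.vs-map W2))))
    edges : esOf S ≡ map ι1 (esOf (st ∷ W1)) ++ (map ι2 (esOf W2) ++ [ N ])
    edges = ≡-trans (map-++ proj₁ (Emb1.mapSt (st ∷ W1)) _)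
      (cong₂ _++_ (Emb1.es-map (st ∷ W1)) (≡-trans (map-++ proj₁ (Emb2.mapSt W2) _) (cong (_++ [ N ]) (Emb2.es-map W2))))
    edgesS : esOf S ↭ layout (esOf (st ∷ W1)) (esOf W2)
    edgesS = ↭-reflexive (≡-trans edges (sym (List.++-assoc (map ι1 (esOf (st ∷ W1))) _ _)))
    apart : Unique (map L (u1 ∷ vsOf (st ∷ W1)) ++ map M (vsOf W2))
    apart = Unique-++⁺ (Unique.map⁺ L-injective dv1) (Unique.map⁺ M-injective dvW2) disjoint
      where
      disjoint : ∀ {x} → x ∈ map L (u1 ∷ vsOf (st ∷ W1)) → x ∉ map M (vsOf W2)
      disjoint p q with ∈-map⁻ L p | ∈-map⁻ M q
      ... | (a , _ , refl) | (b , b∈ , La≡Mb) with M-left (sym La≡Mb)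
      ...   | refl = All.lookup v2∉ b∈ refl
    distinctV : Unique (vsOf S)
    distinctV = subst Unique (sym vertices) (Unique-↭
      (solve 3 (λ x a b → (x ⊕ a) ⊕ b ⊜ a ⊕ (b ⊕ x)) ↭-refl [ L u1 ] (map L (vsOf (st ∷ W1))) (map M (vsOf W2)))
      apart)
      where open ++-Solver {Fin (n1 + m2)}
    distinctE : Unique (esOf S)
    distinctE = Unique-↭ (↭-sym edgesS) (layout-unique de1 de2)

  meet : SidesMeetIn (_≡ v)
  meet (a , refl) (b , refl) j j' with proj₂ (Emb1.incident j) | proj₁ (Emb2.incident j')
  ... | (x , refl) | (y , z≡My) = ≡-trans z≡My (≡-trans (cong M (M-left (sym z≡My))) M-w)

  open Avoiding (_≡ v) (colourChange meet)

  oldSteps : ∀ (X : List (Step G)) → N ∉ esOf X → All (Old ∘ proj₁) X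
  oldSteps X N∉ = All.map⁻ (All.map (λ ne → λ { zero → ne }) (∉⇒All≢ (esOf X) N∉))

  avoiding-v : ∀ (X : List (Step G)) → v ∉ vsOf X → All (λ s → ¬ (proj₂ s ≡ v)) X
  avoiding-v X v∉ = All.map⁻ (∉⇒All≢ (vsOf X) v∉)

  no-crossing : ∀ {z t} P → WalkFromTo G z P t → Joins G N t z → All (Old ∘ proj₁) P → v ∉ vsOf P → ⊥
  no-crossing [] refl jN _ _ with joins-ends {G} endsN jN
  ... | inj₁ (refl , e) = Lu1≢M e
  ... | inj₂ (refl , e) = Mu2≢L e
  no-crossing (s ∷ P) w jN old v∉
    with walk-side (s ∷ P) (λ ()) w old (avoid-all _ (avoiding-v _ v∉)) | joins-ends {G} endsN jN
  ... | inj₁ (_ , _ , _ , z≡ , _) | inj₁ (_ , refl) = Mu2≢L z≡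
  ... | inj₁ (_ , _ , _ , _ , t≡ , _) | inj₂ (refl , _) = Mu2≢L t≡
  ... | inj₂ (_ , _ , _ , _ , t≡ , _) | inj₁ (refl , _) = Lu1≢M t≡
  ... | inj₂ (_ , _ , _ , z≡ , _) | inj₂ (_ , refl) = Lu1≢M z≡

  halves12 : ∀ {C : Cycle G} WA WB → WalkFromTo H1 u1 WA v1 → WalkFromTo H2 v2 WB u2 →
    Unique (vsOf (Emb1.mapSt WA) ++ [ L u1 ]) → Unique (v ∷ vsOf (Emb2.mapSt WB)) →
    Unique ((esOf (Emb1.mapSt WA) ++ esOf (Emb2.mapSt WB)) ++ [ N ]) →
    (esOf (Emb1.mapSt WA) ++ esOf (Emb2.mapSt WB)) ++ [ N ] ↭ cycleEdges C → Halves C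
  halves12 {C} WA WB wA wB dvA dvB de edgesC =
    halves (proj₁ D1) (proj₁ D2) (esOf WA) (esOf WB) (proj₂ D1) (proj₂ D2)
           (↭-sym (subst (λ l → l ++ [ N ] ↭ cycleEdges C) es≡ edgesC))
    where
    es≡ : esOf (Emb1.mapSt WA) ++ esOf (Emb2.mapSt WB) ≡ map ι1 (esOf WA) ++ map ι2 (esOf WB)
    es≡ = cong₂ _++_ (Emb1.es-map WA) (Emb2.es-map WB)
    deAB = Unique-++ˡ (map ι1 (esOf WA) ++ map ι2 (esOf WB)) (subst (λ l → Unique (l ++ [ N ])) es≡ de)
    dvA' : Unique (map L (vsOf WA ++ [ u1 ]))
    dvA' = subst Unique (≡-trans (cong (_++ [ L u1 ]) (Emb1.vs-map WA)) (sym (map-++ L (vsOf WA) [ u1 ]))) dvA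
    dvB' : Unique (map M (v2 ∷ vsOf WB))
    dvB' = subst₂ (λ a l → Unique (a ∷ l)) (sym M-w) (Emb2.vs-map WB) dvB
    D1 = pathToCycle G1 e1 WA wA (Joins-sym {G1} (endUV G1 e1 s1)) u1≢v1
           (Unique-snoc⇒∷ (vsOf WA) u1 (Unique.map⁻ dvA')) (Unique.map⁻ (Unique-++ˡ (map ι1 (esOf WA)) deAB))
    D2 = pathToCycle G2 e2 WB wB (endUV G2 e2 s2) (u2≢v2 ∘ sym)
           (Unique.map⁻ dvB') (Unique.map⁻ (Unique-++ʳ (map ι1 (esOf WA)) deAB))

  halves21 : ∀ {C : Cycle G} WB WA → WalkFromTo H2 u2 WB v2 → WalkFromTo H1 v1 WA u1 →
    Unique (vsOf (Emb2.mapSt WB) ++ [ M u2 ]) → Unique (v ∷ vsOf (Emb1.mapSt WA)) →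
    Unique ((esOf (Emb2.mapSt WB) ++ esOf (Emb1.mapSt WA)) ++ [ N ]) →
    (esOf (Emb2.mapSt WB) ++ esOf (Emb1.mapSt WA)) ++ [ N ] ↭ cycleEdges C → Halves C
  halves21 {C} WB WA wB wA dvB dvA de edgesC =
    halves (proj₁ D1) (proj₁ D2) (esOf WA) (esOf WB) (proj₂ D1) (proj₂ D2)
           (↭-trans (↭-sym (subst (λ l → l ++ [ N ] ↭ cycleEdges C) es≡ edgesC))
                    (++⁺ʳ [ N ] (++-comm (map ι2 (esOf WB)) (map ι1 (esOf WA)))))
    where
    es≡ : esOf (Emb2.mapSt WB) ++ esOf (Emb1.mapSt WA) ≡ map ι2 (esOf WB) ++ map ι1 (esOf WA)
    es≡ = cong₂ _++_ (Emb2.es-map WB) (Emb1.es-map WA)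
    deBA = Unique-++ˡ (map ι2 (esOf WB) ++ map ι1 (esOf WA)) (subst (λ l → Unique (l ++ [ N ])) es≡ de)
    dvB' : Unique (map M (vsOf WB ++ [ u2 ]))
    dvB' = subst Unique (≡-trans (cong (_++ [ M u2 ]) (Emb2.vs-map WB)) (sym (map-++ M (vsOf WB) [ u2 ]))) dvB
    dvA' : Unique (map L (v1 ∷ vsOf WA))
    dvA' = subst (λ l → Unique (v ∷ l)) (Emb1.vs-map WA) dvA
    D1 = pathToCycle G1 e1 WA wA (endUV G1 e1 s1) (u1≢v1 ∘ sym)
           (Unique.map⁻ dvA') (Unique.map⁻ (Unique-++ʳ (map ι2 (esOf WB)) deBA))
    D2 = pathToCycle G2 e2 WB wB (Joins-sym {G2} (endUV G2 e2 s2)) u2≢v2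
           (Unique-snoc⇒∷ (vsOf WB) u2 (Unique.map⁻ dvB')) (Unique.map⁻ (Unique-++ˡ (map ι2 (esOf WB)) deBA))

  halvesThrough : ∀ {C : Cycle G} {z t} A B → WalkFromTo G z A v → WalkFromTo G v B t → Joins G N t z →
    All (Old ∘ proj₁) A → All (Old ∘ proj₁) B → AvoidInner A → AvoidInner B →
    Unique (vsOf A ++ [ z ]) → Unique (v ∷ vsOf B) → Unique ((esOf A ++ esOf B) ++ [ N ]) →
    (esOf A ++ esOf B) ++ [ N ] ↭ cycleEdges C → Halves C
  halvesThrough A B wA wB jN oldA oldB avA avB dvA dvB de edgesC with joins-ends {G} endsN jN
  ... | inj₁ (refl , refl)
    with walk-side A (walk-nonempty A wA (Mu2≢L)) wA oldA avA
       | walk-side B (walk-nonempty B wB (u1≢v1 ∘ sym ∘ L-injective)) wB oldB avB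
  ... | inj₁ (_ , _ , _ , z≡ , _) | _ = ⊥-elim (Mu2≢L z≡)
  ... | inj₂ _ | inj₂ (_ , _ , _ , _ , t≡ , _) = ⊥-elim (Lu1≢M t≡)
  ... | inj₂ (a , b , WB , Mu2≡Ma , v≡Mb , refl , wWB) | inj₁ (c , d , WA , v≡Lc , Lu1≡Ld , refl , wWA)
    with M-injective Mu2≡Ma | M-left (sym v≡Mb) | L-injective v≡Lc | L-injective Lu1≡Ld
  ... | refl | refl | refl | refl = halves21 WB WA wWB wWA dvA dvB de edgesC
  halvesThrough A B wA wB jN oldA oldB avA avB dvA dvB de edgesC | inj₂ (refl , refl)
    with walk-side A (walk-nonempty A wA (u1≢v1 ∘ L-injective)) wA oldA avA
       | walk-side B (walk-nonempty B wB (Mu2≢L ∘ sym)) wB oldB avB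
  ... | inj₂ (_ , _ , _ , z≡ , _) | _ = ⊥-elim (Lu1≢M z≡)
  ... | inj₁ _ | inj₁ (_ , _ , _ , _ , t≡ , _) = ⊥-elim (Mu2≢L t≡)
  ... | inj₁ (a , b , WA , Lu1≡La , v≡Lb , refl , wWA) | inj₂ (c , d , WB , v≡Mc , Mu2≡Md , refl , wWB)
    with L-injective Lu1≡La | L-injective v≡Lb | M-left (sym v≡Mc) | M-injective Mu2≡Md
  ... | refl | refl | refl | refl = halves12 WA WB wWA wWB dvA dvB de edgesC

  -- a cycle through N, cut open at N, passes through v, which splits it
  halvesAt : ∀ {C : Cycle G} {z t} P → WalkFromTo G z P t → Joins G N t z →
             Unique (vsOf P ++ [ z ]) → Unique (esOf P ++ [ N ]) → esOf P ++ [ N ] ↭ cycleEdges C → Halves C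
  halvesAt P wP jN dv de edgesC with any? (v ≟_) (vsOf P)
  ... | no v∉ = ⊥-elim (no-crossing P wP jN (oldSteps P (λ m → Unique-++-disjoint (esOf P) de m (here refl))) v∉)
  ... | yes v∈ with ∈-map⁻ proj₂ v∈
  ... | ((e , .v) , s∈ , refl) with ∈-∃++ s∈
  ... | (A , B , refl) with walk-split A wP
  ... | (p , wA , (je , wB)) =
    halvesThrough (A ++ [ (e , v) ]) B (walk-++ A wA (je , refl)) wB jN
      (All.++⁺ (All.++⁻ˡ A oldP) (All.head (All.++⁻ʳ A oldP) ∷ [])) (All.tail (All.++⁻ʳ A oldP))
      (avoid-snoc A (e , v) (avoiding-v A (λ m → Unique-++-disjoint (vsOf A) dvP m (here refl))))
      (avoid-all B (avoiding-v B (Unique.Unique[x∷xs]⇒x∉xs (proj₂ dvs))))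
      (subst (λ l → Unique (l ++ [ _ ])) (sym (map-++ proj₂ A [ (e , v) ])) (proj₁ dvs)) (proj₂ dvs)
      (subst (λ l → Unique (l ++ [ N ])) es≡ de) (subst (λ l → l ++ [ N ] ↭ _) es≡ edgesC)
    where
    es≡ : esOf (A ++ (e , v) ∷ B) ≡ esOf (A ++ [ (e , v) ]) ++ esOf B
    es≡ = ≡-trans (cong esOf (sym (List.++-assoc A [ (e , v) ] B))) (map-++ proj₁ (A ++ [ (e , v) ]) B)
    oldP : All (Old ∘ proj₁) (A ++ (e , v) ∷ B)
    oldP = oldSteps (A ++ (e , v) ∷ B) (λ m → Unique-++-disjoint (esOf (A ++ (e , v) ∷ B)) de m (here refl))
    dv' : Unique ((vsOf A ++ v ∷ vsOf B) ++ [ _ ])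
    dv' = subst (λ l → Unique (l ++ [ _ ])) (map-++ proj₂ A _) dv
    dvP : Unique (vsOf A ++ v ∷ vsOf B)
    dvP = Unique-++ˡ (vsOf A ++ v ∷ vsOf B) dv'
    dvs = Unique-cut (vsOf A) v (vsOf B) _ dv'

  splitting : Splitting zero
  splitting C N∈ with cutAt C N∈
  ... | cut z t P wP jN dv de edgesC = halvesAt P wP jN dv de edgesC

  result : DefectAdditive G1 G2 (opVE G1 e1 s1 G2 e2 s2)
  result = defect-additive (transfer bridge zero splitting v meet)

-- Theorem 7.

theoremE : (G1 G2 : Graph) → Loopless G1 → Loopless G2 →
  (e1 : Fin (nE G1)) (s1 : Bool) (e2 : Fin (nE G2)) (s2 : Bool) → DefectAdditive G1 G2 (opE G1 e1 s1 G2 e2 s2)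
theoremE = EdgeSum.result

-- for ⊙VE, G2 has a vertex since it has the edge e2
theoremVE : (G1 G2 : Graph) → Loopless G1 → Loopless G2 →
  (e1 : Fin (nE G1)) (s1 : Bool) (e2 : Fin (nE G2)) (s2 : Bool) → DefectAdditive G1 G2 (opVE G1 e1 s1 G2 e2 s2)
theoremVE G1 (graph zero k2 f2) ll1 ll2 e1 s1 e2 s2 with f2 e2
... | () , _
theoremVE G1 (graph (suc m2) k2 f2) ll1 ll2 e1 s1 e2 s2 = VertexEdgeSum.result G1 m2 k2 f2 ll1 ll2 e1 s1 e2 s2

mainTheorem7 :
    ((G1 G2 : Graph) → Loopless G1 → Loopless G2 → Eulerian G1 → Eulerian G2 →
      (w1 : Fin (nV G1)) (w2 : Fin (nV G2)) →
      DefectAdditive G1 G2 (opV G1 w1 G2 w2))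
    ×
    ((G1 G2 : Graph) → Loopless G1 → Loopless G2 → Eulerian G1 → Eulerian G2 →
      (e1 : Fin (nE G1)) (s1 : Bool) (e2 : Fin (nE G2)) (s2 : Bool) →
      DefectAdditive G1 G2 (opE G1 e1 s1 G2 e2 s2))
    ×
    ((G1 G2 : Graph) → Loopless G1 → Loopless G2 → Eulerian G1 → Eulerian G2 →
      (e1 : Fin (nE G1)) (s1 : Bool) (e2 : Fin (nE G2)) (s2 : Bool) →
      DefectAdditive G1 G2 (opVE G1 e1 s1 G2 e2 s2))
mainTheorem7 =
  (λ G1 G2 _ _ _ _ → theoremV G1 G2) ,
  (λ G1 G2 ll1 ll2 _ _ → theoremE G1 G2 ll1 ll2) ,
  (λ G1 G2 ll1 ll2 _ _ → theoremVE G1 G2 ll1 ll2)
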